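{- Let $q=p^s$ with $p$ prime be a square, and let $d\ge3$ be an integer with $d\mid(p-1)$. Then $$\omega(GP(q,d))<\sqrt{\frac qd}\Big(1+\frac1{2\sqrt d}+\frac1{8d}\Big)+1.$$
   Context: For $d>1$ and $q\equiv1\pmod{2d}$ (which holds here), $GP(q,d)$ is the graph on $\mathbb{F}_q$ where distinct $x,y$ are adjacent iff $x-y=z^d$ for some $z\in\mathbb{F}_q$; $\omega$ denotes clique number. -}

module Defs where

open import Level using (0ℓ)
open import Data.Nat using (ℕ; zero; suc)
open import Data.Fin using (Fin)
open import Data.Product using (∃; _×_)
open import Data.List using (List)
open import Data.List.Membership.Propositional using (_∈_)
open import Data.List.Relation.Unary.Unique.Propositional using (Unique)
open import Relation.Nullary using (¬_)
open import Relation.Binary.PropositionalEquality using (_≡_)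
open import Algebra.Structures using (IsCommutativeRing)
open import Function.Bundles using (_↔_)

-- A finite field: a commutative ring (with propositional equality) in which
-- 0 ≠ 1 and every nonzero element has a multiplicative inverse, together with
-- a bijection between its carrier and Fin size (so size = |F| = q).
record FiniteField : Set₁ where
  infixl 6 _+_ _-_
  infixl 7 _*_
  field
    Carrier : Set
    _+_ _*_ : Carrier → Carrier → Carrier
    -_ : Carrier → Carrier
    0# 1# : Carrier
    isCommutativeRing : IsCommutativeRing _≡_ _+_ _*_ -_ 0# 1#
    0≢1 : ¬ (0# ≡ 1#)
    inverse : ∀ x → ¬ (x ≡ 0#) → ∃ λ y → x * y ≡ 1#
    size : ℕ
    enumeration : Carrier ↔ Fin size

  _-_ : Carrier → Carrier → Carrier
  x - y = x + (- y)

  _^_ : Carrier → ℕ → Carrier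
  x ^ zero = 1#
  x ^ suc n = x * (x ^ n)

module _ (F : FiniteField) where
  open FiniteField F

  GPAdj : ℕ → Carrier → Carrier → Set
  GPAdj d x y = ¬ (x ≡ y) × ∃ λ z → x - y ≡ z ^ d

  IsGPClique : ℕ → List Carrier → Set
  IsGPClique d C = Unique C × (∀ {x y} → x ∈ C → y ∈ C → ¬ (x ≡ y) → GPAdj d x y)

{-# OPTIONS --safe #-}
-- Stepanov's method. Write q = d k + 1. Differences of clique vertices are
-- nonzero d-th powers, hence k-th roots of unity. Given M + 1 vertices x of a
-- clique C there are weights ν with ∑ ν x (a - x) ^ m = [m = M] for all a and
-- m ≤ M; the polynomial ∑ ν x (X - x) ^ (k + M) - 1 then has degree k with
-- leading coefficient C(k + M, k), and expanding it around any a ∈ C shows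
-- that it vanishes to order M there. So M |C| ≤ k whenever C(k + M, k) ≠ 0
-- in F. Take for M the number t = |C| - 1 with its base-p digits capped at
-- (d - 1)(p - 1)/d: since k = (p - 1)/d · (1 + p + ... + p ^ (s - 1)), the sum
-- k + M has no carries and Lucas' theorem gives C(k + M, k) ≢ 0 mod p, while
-- still (d - 1) t ≤ d M. Hence (d - 1) t² ≤ d M |C| ≤ d k < q = r², which for
-- d ≥ 3 implies the stated bound.
module Submission where

open import Defs
open import Data.Nat.Base using (ℕ; suc; NonZero)
open import Data.Nat.Primality using (Prime)
open import Relation.Binary.PropositionalEquality.Core using (_≡_)

module FieldArithmetic (F : FiniteField) where

  open import Level using (0ℓ)
  open import Data.Nat as ℕ using (ℕ; zero; suc)
  import Data.Nat.Properties as ℕ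
  open import Data.Integer as ℤ using (ℤ; -[1+_])
  import Data.Integer.Properties as ℤ
  open import Data.Integer.Base using (+-*-rawRing)
  open import Data.Sign as Sign using (Sign)
  open import Data.Maybe using (Maybe; just; nothing)
  open import Data.Product using (proj₁; proj₂)
  open import Data.List using (List; []; _∷_; map)
  open import Data.List.Relation.Unary.All using (All; []; _∷_)
  open import Function using (_∘_)
  open import Data.Fin.Properties using (inj⇒≟)
  open import Function.Properties.Inverse using (↔⇒↣)
  open import Relation.Nullary using (¬_; yes; no; contradiction)
  open import Relation.Binary.Definitions using (DecidableEquality)
  open import Relation.Binary.PropositionalEquality
  open import Algebra.Bundles using (CommutativeRing)
  import Algebra.Solver.Ring.AlmostCommutativeRing as ACR

  open FiniteField F public

  commutativeRing : CommutativeRing 0ℓ 0ℓ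
  commutativeRing = record { isCommutativeRing = isCommutativeRing }

  open CommutativeRing commutativeRing public
    using ( +-assoc; +-comm; +-identityˡ; +-identityʳ; -‿inverseʳ
          ; *-assoc; *-comm; *-identityˡ; *-identityʳ; distribˡ; distribʳ; zeroˡ; zeroʳ
          ; semiring; +-commutativeMonoid; *-commutativeMonoid )
  open import Algebra.Properties.Ring (CommutativeRing.ring commutativeRing) public
    using (-‿distribˡ-*; -‿distribʳ-*; -0#≈0#; -‿involutive; -‿+-comm)
  open import Algebra.Properties.Semiring.Mult semiring public
    using (_×_; ×-homo-+; ×1-homo-*)

  infix 4 _≟_
  _≟_ : DecidableEquality Carrier
  _≟_ = inj⇒≟ (↔⇒↣ enumeration)

  private
    -- The ring solver normalises with integer coefficients, which it
    -- interprets in F along this morphism.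
    fromℤ : ℤ → Carrier
    fromℤ (ℤ.+ n) = n × 1#
    fromℤ -[1+ n ] = - (suc n × 1#)

    fromℤ-⊖ : ∀ m n → fromℤ (m ℤ.⊖ n) ≡ m × 1# - n × 1#
    fromℤ-⊖ zero zero = sym (trans (cong (0# +_) -0#≈0#) (+-identityʳ 0#))
    fromℤ-⊖ (suc m) zero = sym (trans (cong (suc m × 1# +_) -0#≈0#) (+-identityʳ _))
    fromℤ-⊖ zero (suc n) = sym (+-identityˡ _)
    fromℤ-⊖ (suc m) (suc n) = begin
      fromℤ (suc m ℤ.⊖ suc n)               ≡⟨ cong fromℤ (ℤ.[1+m]⊖[1+n]≡m⊖n m n) ⟩
      fromℤ (m ℤ.⊖ n)                       ≡⟨ fromℤ-⊖ m n ⟩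
      m × 1# - n × 1#                       ≡⟨ +-identityˡ _ ⟨
      0# + (m × 1# - n × 1#)                ≡⟨ cong (_+ (m × 1# - n × 1#)) (-‿inverseʳ 1#) ⟨
      (1# - 1#) + (m × 1# - n × 1#)         ≡⟨ interchange 1# (- 1#) (m × 1#) (- (n × 1#)) ⟩
      (1# + m × 1#) + (- 1# + - (n × 1#))   ≡⟨ cong ((1# + m × 1#) +_) (-‿+-comm 1# (n × 1#)) ⟩
      suc m × 1# - suc n × 1#               ∎
      where
      open ≡-Reasoning
      open import Algebra.Properties.CommutativeSemigroup
        (CommutativeRing.+-commutativeSemigroup commutativeRing) using (interchange)

    fromℤ-homo-+ : ∀ i j → fromℤ (i ℤ.+ j) ≡ fromℤ i + fromℤ j
    fromℤ-homo-+ (ℤ.+ m) (ℤ.+ n) = ×-homo-+ 1# m n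
    fromℤ-homo-+ (ℤ.+ m) -[1+ n ] = fromℤ-⊖ m (suc n)
    fromℤ-homo-+ -[1+ m ] (ℤ.+ n) = trans (fromℤ-⊖ n (suc m)) (+-comm _ _)
    fromℤ-homo-+ -[1+ m ] -[1+ n ] = begin
      - (suc (suc (m ℕ.+ n)) × 1#)          ≡⟨ cong (λ k → - (suc k × 1#)) (ℕ.+-suc m n) ⟨
      - ((suc m ℕ.+ suc n) × 1#)            ≡⟨ cong -_ (×-homo-+ 1# (suc m) (suc n)) ⟩
      - (suc m × 1# + suc n × 1#)           ≡⟨ -‿+-comm _ _ ⟨
      - (suc m × 1#) + - (suc n × 1#)       ∎
      where open ≡-Reasoning

    fromℤ-homo-neg : ∀ i → fromℤ (ℤ.- i) ≡ - fromℤ i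
    fromℤ-homo-neg (ℤ.+ zero) = sym -0#≈0#
    fromℤ-homo-neg (ℤ.+ suc n) = refl
    fromℤ-homo-neg -[1+ n ] = sym (-‿involutive _)

    signed : Sign → Carrier → Carrier
    signed Sign.+ x = x
    signed Sign.- x = - x

    fromℤ-◃ : ∀ s n → fromℤ (s ℤ.◃ n) ≡ signed s (n × 1#)
    fromℤ-◃ Sign.+ zero = refl
    fromℤ-◃ Sign.- zero = sym -0#≈0#
    fromℤ-◃ Sign.+ (suc n) = refl
    fromℤ-◃ Sign.- (suc n) = refl

    fromℤ-sign : ∀ i → fromℤ i ≡ signed (ℤ.sign i) (ℤ.∣ i ∣ × 1#)
    fromℤ-sign (ℤ.+ n) = refl
    fromℤ-sign -[1+ n ] = refl

    signed-* : ∀ s t x y → signed (s Sign.* t) (x * y) ≡ signed s x * signed t y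
    signed-* Sign.+ Sign.+ x y = refl
    signed-* Sign.+ Sign.- x y = -‿distribʳ-* x y
    signed-* Sign.- Sign.+ x y = -‿distribˡ-* x y
    signed-* Sign.- Sign.- x y =
      trans (sym (-‿involutive _)) (trans (cong -_ (-‿distribˡ-* x y)) (-‿distribʳ-* (- x) y))

    fromℤ-homo-* : ∀ i j → fromℤ (i ℤ.* j) ≡ fromℤ i * fromℤ j
    fromℤ-homo-* i j = begin
      fromℤ (i ℤ.* j)                                   ≡⟨ fromℤ-◃ s (ℤ.∣ i ∣ ℕ.* ℤ.∣ j ∣) ⟩
      signed s ((ℤ.∣ i ∣ ℕ.* ℤ.∣ j ∣) × 1#)             ≡⟨ cong (signed s) (×1-homo-* ℤ.∣ i ∣ ℤ.∣ j ∣) ⟩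
      signed s (ℤ.∣ i ∣ × 1# * ℤ.∣ j ∣ × 1#)            ≡⟨ signed-* (ℤ.sign i) (ℤ.sign j) _ _ ⟩
      signed (ℤ.sign i) (ℤ.∣ i ∣ × 1#) * signed (ℤ.sign j) (ℤ.∣ j ∣ × 1#)
                                                        ≡⟨ cong₂ _*_ (fromℤ-sign i) (fromℤ-sign j) ⟨
      fromℤ i * fromℤ j ∎
      where
      open ≡-Reasoning
      s : Sign
      s = ℤ.sign i Sign.* ℤ.sign j

    almostCommutativeRing : ACR.AlmostCommutativeRing 0ℓ 0ℓ
    almostCommutativeRing = ACR.fromCommutativeRing commutativeRing

    fromℤ-morphism : +-*-rawRing ACR.-Raw-AlmostCommutative⟶ almostCommutativeRing
    fromℤ-morphism = record
      { ⟦_⟧ = fromℤ ; +-homo = fromℤ-homo-+ ; *-homo = fromℤ-homo-* ; -‿homo = fromℤ-homo-neg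
      ; 0-homo = refl ; 1-homo = +-identityʳ 1# }

    fromℤ-≟ : ∀ i j → Maybe (fromℤ i ≡ fromℤ j)
    fromℤ-≟ i j with i ℤ.≟ j
    ... | yes i≡j = just (cong fromℤ i≡j)
    ... | no _ = nothing

  open import Algebra.Solver.Ring +-*-rawRing almostCommutativeRing fromℤ-morphism fromℤ-≟ public
    using (solve; _:=_; _:+_; _:*_; _:-_; :-_; con)

  x-y≡0⇒x≡y : ∀ {x y} → x - y ≡ 0# → x ≡ y
  x-y≡0⇒x≡y {x} {y} x-y≡0 = begin
    x             ≡⟨ solve 2 (λ x y → x := (x :- y) :+ y) refl x y ⟩
    (x - y) + y   ≡⟨ cong (_+ y) x-y≡0 ⟩
    0# + y        ≡⟨ +-identityˡ y ⟩
    y             ∎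
    where open ≡-Reasoning

  x≢y⇒x-y≢0 : ∀ {x y} → ¬ x ≡ y → ¬ x - y ≡ 0#
  x≢y⇒x-y≢0 x≢y x-y≡0 = x≢y (x-y≡0⇒x≡y x-y≡0)

  -- A total inverse, with junk value 0# ⁻¹ = 0#.
  _⁻¹ : Carrier → Carrier
  x ⁻¹ with x ≟ 0#
  ... | yes _ = 0#
  ... | no x≢0 = proj₁ (inverse x x≢0)

  ⁻¹-inverseʳ : ∀ {x} → ¬ x ≡ 0# → x * x ⁻¹ ≡ 1#
  ⁻¹-inverseʳ {x} x≢0 with x ≟ 0#
  ... | yes x≡0 = contradiction x≡0 x≢0
  ... | no x≢0′ = proj₂ (inverse x x≢0′)

  ⁻¹-inverseˡ : ∀ {x} → ¬ x ≡ 0# → x ⁻¹ * x ≡ 1#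
  ⁻¹-inverseˡ x≢0 = trans (*-comm _ _) (⁻¹-inverseʳ x≢0)

  x*y≡0⇒y≡0 : ∀ {x y} → ¬ x ≡ 0# → x * y ≡ 0# → y ≡ 0#
  x*y≡0⇒y≡0 {x} {y} x≢0 xy≡0 = begin
    y                ≡⟨ *-identityˡ y ⟨
    1# * y           ≡⟨ cong (_* y) (⁻¹-inverseˡ x≢0) ⟨
    (x ⁻¹ * x) * y   ≡⟨ *-assoc _ _ _ ⟩
    x ⁻¹ * (x * y)   ≡⟨ cong (x ⁻¹ *_) xy≡0 ⟩
    x ⁻¹ * 0#        ≡⟨ zeroʳ _ ⟩
    0#               ∎
    where open ≡-Reasoning

  *-≢0 : ∀ {x y} → ¬ x ≡ 0# → ¬ y ≡ 0# → ¬ x * y ≡ 0#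
  *-≢0 x≢0 y≢0 xy≡0 = y≢0 (x*y≡0⇒y≡0 x≢0 xy≡0)

  1≢0 : ¬ 1# ≡ 0#
  1≢0 1≡0 = 0≢1 (sym 1≡0)

  ^-≢0 : ∀ {x} n → ¬ x ≡ 0# → ¬ x ^ n ≡ 0#
  ^-≢0 zero x≢0 = 1≢0
  ^-≢0 (suc n) x≢0 = *-≢0 x≢0 (^-≢0 n x≢0)

  0^n≡0 : ∀ {n} → 0 ℕ.< n → 0# ^ n ≡ 0#
  0^n≡0 {suc n} _ = zeroˡ _

  ^-distribˡ-+-* : ∀ x m n → x ^ (m ℕ.+ n) ≡ x ^ m * x ^ n
  ^-distribˡ-+-* x zero n = sym (*-identityˡ _)
  ^-distribˡ-+-* x (suc m) n = trans (cong (x *_) (^-distribˡ-+-* x m n)) (sym (*-assoc _ _ _))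

  ^-*-assoc : ∀ x m n → (x ^ m) ^ n ≡ x ^ (m ℕ.* n)
  ^-*-assoc x m zero = cong (x ^_) (sym (ℕ.*-zeroʳ m))
  ^-*-assoc x m (suc n) = begin
    x ^ m * (x ^ m) ^ n     ≡⟨ cong (x ^ m *_) (^-*-assoc x m n) ⟩
    x ^ m * x ^ (m ℕ.* n)   ≡⟨ ^-distribˡ-+-* x m (m ℕ.* n) ⟨
    x ^ (m ℕ.+ m ℕ.* n)     ≡⟨ cong (x ^_) (ℕ.*-suc m n) ⟨
    x ^ (m ℕ.* suc n)       ∎
    where open ≡-Reasoning

  ×1-homo-^ : ∀ m n → (m ℕ.^ n) × 1# ≡ (m × 1#) ^ n
  ×1-homo-^ m zero = +-identityʳ 1#
  ×1-homo-^ m (suc n) = trans (×1-homo-* m (m ℕ.^ n)) (cong (m × 1# *_) (×1-homo-^ m n))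

  sumOn : {A : Set} → List A → (A → Carrier) → Carrier
  sumOn [] f = 0#
  sumOn (x ∷ xs) f = f x + sumOn xs f

  sumOn-cong : {A : Set} (xs : List A) {f g : A → Carrier} → All (λ x → f x ≡ g x) xs → sumOn xs f ≡ sumOn xs g
  sumOn-cong [] [] = refl
  sumOn-cong (x ∷ xs) (fx≡gx ∷ eqs) = cong₂ _+_ fx≡gx (sumOn-cong xs eqs)

  sumOn-*ˡ : {A : Set} (xs : List A) (c : Carrier) (f : A → Carrier) → c * sumOn xs f ≡ sumOn xs (λ x → c * f x)
  sumOn-*ˡ [] c f = zeroʳ c
  sumOn-*ˡ (x ∷ xs) c f = trans (distribˡ c _ _) (cong (c * f x +_) (sumOn-*ˡ xs c f))

  sumOn-*-sub : {A : Set} (xs : List A) (f g : A → Carrier) (c : Carrier) →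
    sumOn xs (λ x → f x * (g x - c)) ≡ sumOn xs (λ x → f x * g x) - sumOn xs f * c
  sumOn-*-sub [] f g c = solve 1 (λ c → con (ℤ.+ 0) := con (ℤ.+ 0) :- con (ℤ.+ 0) :* c) refl c
  sumOn-*-sub (x ∷ xs) f g c = trans (cong (f x * (g x - c) +_) (sumOn-*-sub xs f g c))
    (solve 5 (λ a b c s t → a :* (b :- c) :+ (s :- t :* c) := (a :* b :+ s) :- (a :+ t) :* c) refl
      (f x) (g x) c (sumOn xs (λ x → f x * g x)) (sumOn xs f))

  sumOn-map : {A B : Set} (h : A → B) (xs : List A) (f : B → Carrier) → sumOn (map h xs) f ≡ sumOn xs (f ∘ h)
  sumOn-map h [] f = refl
  sumOn-map h (x ∷ xs) f = cong (f (h x) +_) (sumOn-map h xs f)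

module Polynomials (F : FiniteField) where

  open FieldArithmetic F
  open import Level using (0ℓ)
  open import Data.Nat as ℕ using (ℕ; zero; suc; _≤_; _<_; z≤n; s≤s)
  import Data.Nat.Properties as ℕ
  open import Data.List using (List; []; _∷_; length)
  open import Relation.Binary.PropositionalEquality
  open import Relation.Binary.Bundles using (Setoid)
  open import Relation.Binary.Structures using (IsEquivalence)
  open import Algebra.Bundles using (CommutativeMonoid)
  import Relation.Binary.Reasoning.Setoid
  open import Data.Product using (_,_)
  import Data.Integer as ℤ

  -- Coefficient lists, constant term first.
  Poly : Set
  Poly = List Carrier

  coeff : Poly → ℕ → Carrier
  coeff [] _ = 0#
  coeff (a ∷ p) zero = a
  coeff (a ∷ p) (suc i) = coeff p i

  infix 4 _≈_
  record _≈_ (p q : Poly) : Set where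
    constructor coeffwise
    field coeff-cong : ∀ i → coeff p i ≡ coeff q i
  open _≈_ public

  ≈-isEquivalence : IsEquivalence _≈_
  ≈-isEquivalence = record
    { refl = coeffwise λ _ → refl
    ; sym = λ p≈q → coeffwise λ i → sym (coeff-cong p≈q i)
    ; trans = λ p≈q q≈r → coeffwise λ i → trans (coeff-cong p≈q i) (coeff-cong q≈r i)
    }

  ≈-setoid : Setoid 0ℓ 0ℓ
  ≈-setoid = record { isEquivalence = ≈-isEquivalence }

  open IsEquivalence ≈-isEquivalence public
    using () renaming (refl to ≈-refl; sym to ≈-sym; trans to ≈-trans; reflexive to ≈-reflexive)
  module ≈-Reasoning = Relation.Binary.Reasoning.Setoid ≈-setoid

  IsZero : Poly → Set
  IsZero p = ∀ i → coeff p i ≡ 0#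

  infix 4 _deg<_
  _deg<_ : Poly → ℕ → Set
  p deg< n = ∀ i → n ≤ i → coeff p i ≡ 0#

  1ₚ : Poly
  1ₚ = 1# ∷ []

  infixl 6 _⊕_ _⊖_
  infixr 7 _·_ [X-_]*_ [X-_]^_*_

  _⊕_ : Poly → Poly → Poly
  [] ⊕ q = q
  (a ∷ p) ⊕ [] = a ∷ p
  (a ∷ p) ⊕ (b ∷ q) = (a + b) ∷ (p ⊕ q)

  _·_ : Carrier → Poly → Poly
  c · [] = []
  c · (a ∷ p) = c * a ∷ c · p

  _⊖_ : Poly → Poly → Poly
  p ⊖ q = p ⊕ (- 1#) · q

  [X-_]*_ : Carrier → Poly → Poly
  [X- c ]* p = (0# ∷ p) ⊕ (- c) · p

  [X-_]^_*_ : Carrier → ℕ → Poly → Poly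
  [X- c ]^ zero * p = p
  [X- c ]^ suc n * p = [X- c ]* [X- c ]^ n * p

  coeff-⊕ : ∀ p q i → coeff (p ⊕ q) i ≡ coeff p i + coeff q i
  coeff-⊕ [] q i = sym (+-identityˡ _)
  coeff-⊕ (a ∷ p) [] i = sym (+-identityʳ _)
  coeff-⊕ (a ∷ p) (b ∷ q) zero = refl
  coeff-⊕ (a ∷ p) (b ∷ q) (suc i) = coeff-⊕ p q i

  coeff-· : ∀ c p i → coeff (c · p) i ≡ c * coeff p i
  coeff-· c [] i = sym (zeroʳ c)
  coeff-· c (a ∷ p) zero = refl
  coeff-· c (a ∷ p) (suc i) = coeff-· c p i

  coeff-⊖ : ∀ p q i → coeff (p ⊖ q) i ≡ coeff p i - coeff q i
  coeff-⊖ p q i = begin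
    coeff (p ⊖ q) i                   ≡⟨ coeff-⊕ p _ i ⟩
    coeff p i + coeff ((- 1#) · q) i   ≡⟨ cong (coeff p i +_) (coeff-· (- 1#) q i) ⟩
    coeff p i + (- 1#) * coeff q i     ≡⟨ cong (coeff p i +_) (-‿distribˡ-* 1# _) ⟨
    coeff p i - 1# * coeff q i         ≡⟨ cong (λ x → coeff p i - x) (*-identityˡ _) ⟩
    coeff p i - coeff q i             ∎
    where open ≡-Reasoning

  coeff-[X-]* : ∀ c p i → coeff ([X- c ]* p) i ≡ coeff (0# ∷ p) i - c * coeff p i
  coeff-[X-]* c p i = begin
    coeff ([X- c ]* p) i                          ≡⟨ coeff-⊕ (0# ∷ p) ((- c) · p) i ⟩
    coeff (0# ∷ p) i + coeff ((- c) · p) i        ≡⟨ cong (coeff (0# ∷ p) i +_) (coeff-· (- c) p i) ⟩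
    coeff (0# ∷ p) i + (- c) * coeff p i          ≡⟨ cong (coeff (0# ∷ p) i +_) (-‿distribˡ-* c _) ⟨
    coeff (0# ∷ p) i - c * coeff p i              ∎
    where open ≡-Reasoning

  ⊕-cong : ∀ {p p′ q q′} → p ≈ p′ → q ≈ q′ → p ⊕ q ≈ p′ ⊕ q′
  ⊕-cong {p} {p′} {q} {q′} p≈p′ q≈q′ = coeffwise λ i → begin
    coeff (p ⊕ q) i           ≡⟨ coeff-⊕ p q i ⟩
    coeff p i + coeff q i     ≡⟨ cong₂ _+_ (coeff-cong p≈p′ i) (coeff-cong q≈q′ i) ⟩
    coeff p′ i + coeff q′ i   ≡⟨ coeff-⊕ p′ q′ i ⟨
    coeff (p′ ⊕ q′) i         ∎
    where open ≡-Reasoning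

  ⊕-congˡ : ∀ p {q q′} → q ≈ q′ → p ⊕ q ≈ p ⊕ q′
  ⊕-congˡ p = ⊕-cong (≈-refl {p})

  ·-congʳ : ∀ c {p q} → p ≈ q → c · p ≈ c · q
  ·-congʳ c {p} {q} p≈q = coeffwise λ i →
    trans (coeff-· c p i) (trans (cong (c *_) (coeff-cong p≈q i)) (sym (coeff-· c q i)))

  ⊖-cong : ∀ {p p′ q q′} → p ≈ p′ → q ≈ q′ → p ⊖ q ≈ p′ ⊖ q′
  ⊖-cong p≈p′ q≈q′ = ⊕-cong p≈p′ (·-congʳ (- 1#) q≈q′)

  ⊕-comm : ∀ p q → p ⊕ q ≈ q ⊕ p
  ⊕-comm p q = coeffwise λ i → trans (coeff-⊕ p q i) (trans (+-comm _ _) (sym (coeff-⊕ q p i)))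

  ⊕-assoc : ∀ p q r → (p ⊕ q) ⊕ r ≈ p ⊕ (q ⊕ r)
  ⊕-assoc p q r = coeffwise λ i → begin
    coeff ((p ⊕ q) ⊕ r) i                ≡⟨ coeff-⊕ (p ⊕ q) r i ⟩
    coeff (p ⊕ q) i + coeff r i          ≡⟨ cong (_+ coeff r i) (coeff-⊕ p q i) ⟩
    coeff p i + coeff q i + coeff r i    ≡⟨ +-assoc _ _ _ ⟩
    coeff p i + (coeff q i + coeff r i)  ≡⟨ cong (coeff p i +_) (coeff-⊕ q r i) ⟨
    coeff p i + coeff (q ⊕ r) i          ≡⟨ coeff-⊕ p (q ⊕ r) i ⟨
    coeff (p ⊕ (q ⊕ r)) i                ∎
    where open ≡-Reasoning

  ⊕-identityʳ : ∀ p → p ⊕ [] ≈ p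
  ⊕-identityʳ p = coeffwise λ i → trans (coeff-⊕ p [] i) (+-identityʳ _)

  ⊕-commutativeMonoid : CommutativeMonoid 0ℓ 0ℓ
  ⊕-commutativeMonoid = record
    { Carrier = Poly ; _≈_ = _≈_ ; _∙_ = _⊕_ ; ε = []
    ; isCommutativeMonoid = record
      { isMonoid = record
        { isSemigroup = record
          { isMagma = record { isEquivalence = ≈-isEquivalence ; ∙-cong = ⊕-cong }
          ; assoc = ⊕-assoc }
        ; identity = (λ _ → ≈-refl) , ⊕-identityʳ }
      ; comm = ⊕-comm }
    }

  open import Algebra.Properties.CommutativeSemigroup
    (CommutativeMonoid.commutativeSemigroup ⊕-commutativeMonoid) public
    using () renaming (interchange to ⊕-interchange; x∙yz≈y∙xz to ⊕-leftComm)

  ⊕-zeroʳ : ∀ p {q} → IsZero q → p ⊕ q ≈ p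
  ⊕-zeroʳ p {q} q≡0 = ≈-trans (⊕-congˡ p (coeffwise {q} q≡0)) (⊕-identityʳ p)

  ⊕-⊖-cancel : ∀ p q → (p ⊕ q) ⊖ p ≈ q
  ⊕-⊖-cancel p q = coeffwise λ i → begin
    coeff ((p ⊕ q) ⊖ p) i              ≡⟨ coeff-⊖ (p ⊕ q) p i ⟩
    coeff (p ⊕ q) i - coeff p i        ≡⟨ cong (_- coeff p i) (coeff-⊕ p q i) ⟩
    (coeff p i + coeff q i) - coeff p i ≡⟨ solve 2 (λ x y → (x :+ y) :- x := y) refl (coeff p i) (coeff q i) ⟩
    coeff q i                          ∎
    where open ≡-Reasoning

  ⊖-zero⇒≈ : ∀ {p q} → IsZero (p ⊖ q) → p ≈ q
  ⊖-zero⇒≈ {p} {q} p-q≡0 = coeffwise λ i → x-y≡0⇒x≡y (trans (sym (coeff-⊖ p q i)) (p-q≡0 i))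

  ·-assoc : ∀ a b p → a · (b · p) ≈ (a * b) · p
  ·-assoc a b p = coeffwise λ i → begin
    coeff (a · (b · p)) i     ≡⟨ coeff-· a (b · p) i ⟩
    a * coeff (b · p) i       ≡⟨ cong (a *_) (coeff-· b p i) ⟩
    a * (b * coeff p i)       ≡⟨ *-assoc _ _ _ ⟨
    a * b * coeff p i         ≡⟨ coeff-· (a * b) p i ⟨
    coeff ((a * b) · p) i     ∎
    where open ≡-Reasoning

  ·-distribʳ : ∀ a b p → a · p ⊕ b · p ≈ (a + b) · p
  ·-distribʳ a b p = coeffwise λ i → begin
    coeff (a · p ⊕ b · p) i                 ≡⟨ coeff-⊕ (a · p) (b · p) i ⟩
    coeff (a · p) i + coeff (b · p) i       ≡⟨ cong₂ _+_ (coeff-· a p i) (coeff-· b p i) ⟩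
    a * coeff p i + b * coeff p i           ≡⟨ distribʳ _ _ _ ⟨
    (a + b) * coeff p i                     ≡⟨ coeff-· (a + b) p i ⟨
    coeff ((a + b) · p) i                   ∎
    where open ≡-Reasoning

  ·-distribˡ : ∀ a p q → a · (p ⊕ q) ≈ a · p ⊕ a · q
  ·-distribˡ a p q = coeffwise λ i → begin
    coeff (a · (p ⊕ q)) i                   ≡⟨ coeff-· a (p ⊕ q) i ⟩
    a * coeff (p ⊕ q) i                     ≡⟨ cong (a *_) (coeff-⊕ p q i) ⟩
    a * (coeff p i + coeff q i)             ≡⟨ distribˡ _ _ _ ⟩
    a * coeff p i + a * coeff q i           ≡⟨ cong₂ _+_ (coeff-· a p i) (coeff-· a q i) ⟨
    coeff (a · p) i + coeff (a · q) i       ≡⟨ coeff-⊕ (a · p) (a · q) i ⟨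
    coeff (a · p ⊕ a · q) i                 ∎
    where open ≡-Reasoning

  ·-identityˡ : ∀ p → 1# · p ≈ p
  ·-identityˡ p = coeffwise λ i → trans (coeff-· 1# p i) (*-identityˡ _)

  ·-zeroˡ : ∀ p → IsZero (0# · p)
  ·-zeroˡ p i = trans (coeff-· 0# p i) (zeroˡ _)

  [X-]*-cong : ∀ c {p q} → p ≈ q → [X- c ]* p ≈ [X- c ]* q
  [X-]*-cong c p≈q = ⊕-cong (coeffwise λ { zero → refl ; (suc i) → coeff-cong p≈q i }) (·-congʳ (- c) p≈q)

  [X-]*-⊕ : ∀ c p q → [X- c ]* (p ⊕ q) ≈ [X- c ]* p ⊕ [X- c ]* q
  [X-]*-⊕ c p q = ≈-trans (⊕-cong shift-⊕ (·-distribˡ (- c) p q))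
    (⊕-interchange (0# ∷ p) (0# ∷ q) ((- c) · p) ((- c) · q))
    where
    shift-⊕ : 0# ∷ (p ⊕ q) ≈ (0# ∷ p) ⊕ (0# ∷ q)
    shift-⊕ = coeffwise λ { zero → sym (+-identityˡ 0#) ; (suc i) → refl }

  [X-]*-· : ∀ c a p → [X- c ]* (a · p) ≈ a · [X- c ]* p
  [X-]*-· c a p = ≈-sym (≈-trans (·-distribˡ a (0# ∷ p) ((- c) · p)) (⊕-cong shift-· (≈-trans (·-assoc a (- c) p)
    (≈-trans (≈-reflexive (cong (_· p) (*-comm a (- c)))) (≈-sym (·-assoc (- c) a p))))))
    where
    shift-· : a · (0# ∷ p) ≈ 0# ∷ (a · p)
    shift-· = coeffwise λ { zero → zeroʳ a ; (suc i) → refl }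

  [X-]*-⊖ : ∀ c p q → [X- c ]* (p ⊖ q) ≈ [X- c ]* p ⊖ [X- c ]* q
  [X-]*-⊖ c p q = ≈-trans ([X-]*-⊕ c p ((- 1#) · q)) (⊕-congˡ ([X- c ]* p) ([X-]*-· c (- 1#) q))

  [X-]*-recentre : ∀ c c′ p → [X- c ]* p ≈ [X- c′ ]* p ⊕ (c′ - c) · p
  [X-]*-recentre c c′ p = coeffwise λ i → begin
    coeff ([X- c ]* p) i
      ≡⟨ coeff-[X-]* c p i ⟩
    s i - c * coeff p i
      ≡⟨ solve 4 (λ c c′ s x → s :- c :* x := (s :- c′ :* x) :+ (c′ :- c) :* x) refl c c′ (s i) (coeff p i) ⟩
    (s i - c′ * coeff p i) + (c′ - c) * coeff p i
      ≡⟨ cong₂ _+_ (coeff-[X-]* c′ p i) (coeff-· (c′ - c) p i) ⟨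
    coeff ([X- c′ ]* p) i + coeff ((c′ - c) · p) i
      ≡⟨ coeff-⊕ ([X- c′ ]* p) _ i ⟨
    coeff ([X- c′ ]* p ⊕ (c′ - c) · p) i ∎
    where
    open ≡-Reasoning
    s : ℕ → Carrier
    s = coeff (0# ∷ p)

  [X-]*-comm : ∀ c c′ p → [X- c ]* [X- c′ ]* p ≈ [X- c′ ]* [X- c ]* p
  [X-]*-comm c c′ p = coeffwise λ i → begin
    coeff ([X- c ]* [X- c′ ]* p) i
      ≡⟨ coeff-[X-]* c _ i ⟩
    coeff (0# ∷ [X- c′ ]* p) i - c * coeff ([X- c′ ]* p) i
      ≡⟨ cong₂ (λ u v → u - c * v) (shifted c′ i) (coeff-[X-]* c′ p i) ⟩
    (s₂ i - c′ * s₁ i) - c * (s₁ i - c′ * coeff p i)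
      ≡⟨ solve 5 (λ c c′ a x y → (a :- c′ :* x) :- c :* (x :- c′ :* y) := (a :- c :* x) :- c′ :* (x :- c :* y)) refl c c′ (s₂ i) (s₁ i) (coeff p i) ⟩
    (s₂ i - c * s₁ i) - c′ * (s₁ i - c * coeff p i)
      ≡⟨ cong₂ (λ u v → u - c′ * v) (shifted c i) (coeff-[X-]* c p i) ⟨
    coeff (0# ∷ [X- c ]* p) i - c′ * coeff ([X- c ]* p) i
      ≡⟨ coeff-[X-]* c′ _ i ⟨
    coeff ([X- c′ ]* [X- c ]* p) i ∎
    where
    open ≡-Reasoning
    s₁ s₂ : ℕ → Carrier
    s₁ = coeff (0# ∷ p)
    s₂ = coeff (0# ∷ 0# ∷ p)
    shifted : ∀ a i → coeff (0# ∷ [X- a ]* p) i ≡ s₂ i - a * s₁ i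
    shifted a zero = solve 1 (λ a → con (ℤ.+ 0) := con (ℤ.+ 0) :- a :* con (ℤ.+ 0)) refl a
    shifted a (suc i) = coeff-[X-]* a p i

  [X-]^-+ : ∀ c m n p → [X- c ]^ (m ℕ.+ n) * p ≡ [X- c ]^ m * [X- c ]^ n * p
  [X-]^-+ c zero n p = refl
  [X-]^-+ c (suc m) n p = cong ([X- c ]*_) ([X-]^-+ c m n p)

  [X-]^-· : ∀ c n a p → [X- c ]^ n * (a · p) ≈ a · [X- c ]^ n * p
  [X-]^-· c zero a p = ≈-refl
  [X-]^-· c (suc n) a p = ≈-trans ([X-]*-cong c ([X-]^-· c n a p)) ([X-]*-· c a ([X- c ]^ n * p))

  ∑ : ℕ → (ℕ → Poly) → Poly
  ∑ zero f = []
  ∑ (suc n) f = f 0 ⊕ ∑ n (λ j → f (suc j))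

  infixr 6.5 ∑ ∑ₗ
  syntax ∑ n (λ j → p) = ∑[ j < n ] p

  ∑-cong : ∀ n {f g : ℕ → Poly} → (∀ j → j < n → f j ≈ g j) → ∑ n f ≈ ∑ n g
  ∑-cong zero f≈g = ≈-refl
  ∑-cong (suc n) f≈g = ⊕-cong (f≈g 0 (s≤s z≤n)) (∑-cong n λ j j<n → f≈g (suc j) (s≤s j<n))

  ∑-zero : ∀ n {f : ℕ → Poly} → (∀ j → j < n → IsZero (f j)) → IsZero (∑ n f)
  ∑-zero zero f≡0 i = refl
  ∑-zero (suc n) {f} f≡0 i = begin
    coeff (f 0 ⊕ ∑[ j < n ] f (suc j)) i
      ≡⟨ coeff-⊕ (f 0) _ i ⟩
    coeff (f 0) i + coeff (∑[ j < n ] f (suc j)) i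
      ≡⟨ cong₂ _+_ (f≡0 0 (s≤s z≤n) i) (∑-zero n (λ j j<n → f≡0 (suc j) (s≤s j<n)) i) ⟩
    0# + 0#
      ≡⟨ +-identityˡ 0# ⟩
    0# ∎
    where open ≡-Reasoning

  ∑-head : ∀ n f → (∀ j → j < n → IsZero (f (suc j))) → ∑ (suc n) f ≈ f 0
  ∑-head n f tail≡0 = ⊕-zeroʳ (f 0) (∑-zero n tail≡0)

  ∑-⊕ : ∀ n f g → ∑[ j < n ] (f j ⊕ g j) ≈ ∑ n f ⊕ ∑ n g
  ∑-⊕ zero f g = ≈-refl
  ∑-⊕ (suc n) f g = ≈-trans (⊕-congˡ (f 0 ⊕ g 0) (∑-⊕ n _ _)) (⊕-interchange (f 0) (g 0) _ _)

  ∑-split : ∀ m n f → ∑ (m ℕ.+ n) f ≈ ∑ m f ⊕ ∑[ j < n ] f (m ℕ.+ j)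
  ∑-split zero n f = ≈-refl
  ∑-split (suc m) n f = ≈-trans (⊕-congˡ (f 0) (∑-split m n (λ j → f (suc j)))) (≈-sym (⊕-assoc (f 0) _ _))

  ∑-last : ∀ n f → ∑ (suc n) f ≈ ∑ n f ⊕ f n
  ∑-last zero f = ⊕-identityʳ (f 0)
  ∑-last (suc n) f = ≈-trans (⊕-congˡ (f 0) (∑-last n (λ j → f (suc j)))) (≈-sym (⊕-assoc (f 0) _ _))

  ·-∑ : ∀ a n f → a · ∑ n f ≈ ∑[ j < n ] a · f j
  ·-∑ a zero f = ≈-refl
  ·-∑ a (suc n) f = ≈-trans (·-distribˡ a (f 0) _) (⊕-congˡ (a · f 0) (·-∑ a n _))

  [X-]*-∑ : ∀ c n f → [X- c ]* ∑ n f ≈ ∑[ j < n ] [X- c ]* f j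
  [X-]*-∑ c zero f = coeffwise λ { zero → refl ; (suc i) → refl }
  [X-]*-∑ c (suc n) f = ≈-trans ([X-]*-⊕ c (f 0) _) (⊕-congˡ ([X- c ]* f 0) ([X-]*-∑ c n _))

  [X-]^-∑ : ∀ c m n f → [X- c ]^ m * ∑ n f ≈ ∑[ j < n ] [X- c ]^ m * f j
  [X-]^-∑ c zero n f = ≈-refl
  [X-]^-∑ c (suc m) n f = ≈-trans ([X-]*-cong c ([X-]^-∑ c m n f)) ([X-]*-∑ c n _)

  ∑ₗ : {A : Set} → List A → (A → Poly) → Poly
  ∑ₗ [] f = []
  ∑ₗ (x ∷ xs) f = f x ⊕ ∑ₗ xs f

  syntax ∑ₗ xs (λ x → p) = ∑[ x ∈ xs ] p

  coeff-∑ₗ : {A : Set} (xs : List A) (f : A → Poly) (i : ℕ) → coeff (∑ₗ xs f) i ≡ sumOn xs (λ x → coeff (f x) i)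
  coeff-∑ₗ [] f i = refl
  coeff-∑ₗ (x ∷ xs) f i = trans (coeff-⊕ (f x) _ i) (cong (coeff (f x) i +_) (coeff-∑ₗ xs f i))

  ∑ₗ-cong : {A : Set} (xs : List A) {f g : A → Poly} → (∀ x → f x ≈ g x) → ∑ₗ xs f ≈ ∑ₗ xs g
  ∑ₗ-cong [] f≈g = ≈-refl
  ∑ₗ-cong (x ∷ xs) f≈g = ⊕-cong (f≈g x) (∑ₗ-cong xs f≈g)

  ∑ₗ-∑-comm : {A : Set} (xs : List A) (α : A → Carrier) (n : ℕ) (β : A → ℕ → Carrier) (Y : ℕ → Poly) →
    ∑[ x ∈ xs ] α x · (∑[ j < n ] β x j · Y j) ≈ ∑[ j < n ] sumOn xs (λ x → α x * β x j) · Y j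
  ∑ₗ-∑-comm [] α n β Y = ≈-sym (coeffwise (∑-zero n λ j _ → ·-zeroˡ (Y j)))
  ∑ₗ-∑-comm (x ∷ xs) α n β Y = begin
    α x · (∑[ j < n ] β x j · Y j) ⊕ (∑[ y ∈ xs ] α y · (∑[ j < n ] β y j · Y j))
      ≈⟨ ⊕-cong (·-∑ (α x) n _) (∑ₗ-∑-comm xs α n β Y) ⟩
    ∑[ j < n ] α x · β x j · Y j ⊕ (∑[ j < n ] S j · Y j)
      ≈⟨ ∑-⊕ n _ _ ⟨
    ∑[ j < n ] (α x · β x j · Y j ⊕ S j · Y j)
      ≈⟨ ∑-cong n (λ j _ → ⊕-cong (·-assoc (α x) (β x j) (Y j)) ≈-refl) ⟩
    ∑[ j < n ] ((α x * β x j) · Y j ⊕ S j · Y j)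
      ≈⟨ ∑-cong n (λ j _ → ·-distribʳ (α x * β x j) (S j) (Y j)) ⟩
    ∑[ j < n ] (α x * β x j + S j) · Y j ∎
    where
    open ≈-Reasoning
    S : ℕ → Carrier
    S j = sumOn xs (λ y → α y * β y j)

  coeff-length : ∀ p i → length p ≤ i → coeff p i ≡ 0#
  coeff-length [] i _ = refl
  coeff-length (a ∷ p) (suc i) (s≤s len≤i) = coeff-length p i len≤i

  -- Descend from the length of q, beyond which all coefficients vanish.
  deg<-by-recurrence : ∀ q b n → (∀ i → n ≤ i → coeff q i ≡ b * coeff q (suc i)) → q deg< n
  deg<-by-recurrence q b n rec i n≤i = go (length q) i (ℕ.m≤m+n (length q) i) n≤i
    where
    go : ∀ m i → length q ≤ m ℕ.+ i → n ≤ i → coeff q i ≡ 0#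
    go zero i len≤i _ = coeff-length q i len≤i
    go (suc m) i len≤m+i n≤i = begin
      coeff q i
        ≡⟨ rec i n≤i ⟩
      b * coeff q (suc i)
        ≡⟨ cong (b *_) (go m (suc i) (subst (length q ≤_) (sym (ℕ.+-suc m i)) len≤m+i) (ℕ.m≤n⇒m≤1+n n≤i)) ⟩
      b * 0#
        ≡⟨ zeroʳ b ⟩
      0# ∎
      where open ≡-Reasoning

module BinomialExpansion (F : FiniteField) where

  open FieldArithmetic F
  open Polynomials F
  open import Data.Nat as ℕ using (ℕ; zero; suc; _∸_; _<_; s≤s)
  import Data.Nat.Properties as ℕ
  open import Data.Nat.Combinatorics using (_C_; k>n⇒nCk≡0; nCk+nC[k+1]≡[n+1]C[k+1])
  open import Relation.Binary.PropositionalEquality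
  open import Relation.Nullary using (yes; no)
  import Data.Integer as ℤ

  -- The coefficient of Y ^ j in (Y + w) ^ n.
  binomialCoeff : ℕ → ℕ → Carrier → Carrier
  binomialCoeff n j w = (n C j) × 1# * w ^ (n ∸ j)

  binomialCoeff-vanishes : ∀ {n j} w → n < j → binomialCoeff n j w ≡ 0#
  binomialCoeff-vanishes {n} {j} w n<j = trans (cong (λ m → m × 1# * w ^ (n ∸ j)) (k>n⇒nCk≡0 n<j)) (zeroˡ _)

  pascal : ∀ n j w → binomialCoeff n j w + w * binomialCoeff n (suc j) w ≡ binomialCoeff (suc n) (suc j) w
  pascal n j w with j ℕ.<? n
  ... | yes j<n = begin
    a × 1# * w ^ (n ∸ j) + w * (b × 1# * w ^ (n ∸ suc j))
      ≡⟨ cong (λ e → a × 1# * w ^ e + w * (b × 1# * w ^ (n ∸ suc j))) n-j≡1+n-[1+j] ⟩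
    a × 1# * (w * w ^ (n ∸ suc j)) + w * (b × 1# * w ^ (n ∸ suc j))
      ≡⟨ solve 4 (λ a b w x → a :* (w :* x) :+ w :* (b :* x) := (a :+ b) :* (w :* x)) refl (a × 1#) (b × 1#) w (w ^ (n ∸ suc j)) ⟩
    (a × 1# + b × 1#) * (w * w ^ (n ∸ suc j))
      ≡⟨ cong₂ (λ m e → m * w ^ e) (trans (sym (×-homo-+ 1# a b)) (cong (_× 1#) (nCk+nC[k+1]≡[n+1]C[k+1] n j))) (sym n-j≡1+n-[1+j]) ⟩
    (suc n C suc j) × 1# * w ^ (n ∸ j) ∎
    where
    open ≡-Reasoning
    a b : ℕ
    a = n C j
    b = n C suc j
    n-j≡1+n-[1+j] : n ∸ j ≡ suc (n ∸ suc j)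
    n-j≡1+n-[1+j] = ℕ.+-∸-assoc 1 j<n
  ... | no j≮n = begin
    binomialCoeff n j w + w * binomialCoeff n (suc j) w
      ≡⟨ cong (λ x → binomialCoeff n j w + w * x) (binomialCoeff-vanishes w n<1+j) ⟩
    binomialCoeff n j w + w * 0#
      ≡⟨ solve 2 (λ x w → x :+ w :* con (ℤ.+ 0) := x) refl (binomialCoeff n j w) w ⟩
    binomialCoeff n j w
      ≡⟨ cong (λ m → m × 1# * w ^ (n ∸ j)) (trans (sym (ℕ.+-identityʳ (n C j))) (cong ((n C j) ℕ.+_) (sym (k>n⇒nCk≡0 n<1+j)))) ⟩
    (n C j ℕ.+ n C suc j) × 1# * w ^ (n ∸ j)
      ≡⟨ cong (λ m → m × 1# * w ^ (n ∸ j)) (nCk+nC[k+1]≡[n+1]C[k+1] n j) ⟩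
    binomialCoeff (suc n) (suc j) w ∎
    where
    open ≡-Reasoning
    n<1+j : n < suc j
    n<1+j = s≤s (ℕ.≮⇒≥ j≮n)

  coeff-[X-]^ : ∀ u n i → coeff ([X- u ]^ n * 1ₚ) i ≡ binomialCoeff n i (- u)
  coeff-[X-]^ u zero zero = sym (trans (*-identityʳ _) (+-identityʳ 1#))
  coeff-[X-]^ u zero (suc i) = sym (zeroˡ _)
  coeff-[X-]^ u (suc n) zero = begin
    coeff ([X- u ]* P) 0
      ≡⟨ coeff-[X-]* u P 0 ⟩
    0# - u * coeff P 0
      ≡⟨ cong (λ x → 0# - u * x) (coeff-[X-]^ u n 0) ⟩
    0# - u * (1 × 1# * (- u) ^ n)
      ≡⟨ solve 3 (λ o u x → con (ℤ.+ 0) :- u :* (o :* x) := o :* ((:- u) :* x)) refl (1 × 1#) u ((- u) ^ n) ⟩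
    1 × 1# * (- u) ^ suc n ∎
    where
    open ≡-Reasoning
    P : Poly
    P = [X- u ]^ n * 1ₚ
  coeff-[X-]^ u (suc n) (suc i) = begin
    coeff ([X- u ]* P) (suc i)
      ≡⟨ coeff-[X-]* u P (suc i) ⟩
    coeff P i - u * coeff P (suc i)
      ≡⟨ cong₂ (λ x y → x - u * y) (coeff-[X-]^ u n i) (coeff-[X-]^ u n (suc i)) ⟩
    binomialCoeff n i (- u) - u * binomialCoeff n (suc i) (- u)
      ≡⟨ cong (binomialCoeff n i (- u) +_) (-‿distribˡ-* u _) ⟩
    binomialCoeff n i (- u) + (- u) * binomialCoeff n (suc i) (- u) ≡⟨ pascal n i (- u) ⟩
    binomialCoeff (suc n) (suc i) (- u)                           ∎
    where
    open ≡-Reasoning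
    P : Poly
    P = [X- u ]^ n * 1ₚ

  [X-]^-deg< : ∀ u n → [X- u ]^ n * 1ₚ deg< suc n
  [X-]^-deg< u n i n<i = trans (coeff-[X-]^ u n i) (binomialCoeff-vanishes (- u) n<i)

  -- (X - u) ^ n = ((X - v) + (v - u)) ^ n
  [X-]^-recentre : ∀ u v n → [X- u ]^ n * 1ₚ ≈ ∑[ j < suc n ] binomialCoeff n j (v - u) · [X- v ]^ j * 1ₚ
  [X-]^-recentre u v zero = ≈-sym (≈-trans (⊕-identityʳ _)
    (≈-trans (≈-reflexive (cong (_· 1ₚ) (trans (*-identityʳ _) (+-identityʳ 1#)))) (·-identityˡ 1ₚ)))
  [X-]^-recentre u v (suc n) = begin
    [X- u ]* [X- u ]^ n * 1ₚ
      ≈⟨ [X-]*-cong u ([X-]^-recentre u v n) ⟩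
    [X- u ]* ∑ (suc n) f
      ≈⟨ [X-]*-recentre u v (∑ (suc n) f) ⟩
    [X- v ]* ∑ (suc n) f ⊕ w · ∑ (suc n) f
      ≈⟨ ⊕-cong raised scaled ⟩
    ∑ (suc n) g ⊕ ((w * b n 0) · Y 0 ⊕ ∑ (suc n) h)
      ≈⟨ ⊕-leftComm (∑ (suc n) g) ((w * b n 0) · Y 0) (∑ (suc n) h) ⟩
    (w * b n 0) · Y 0 ⊕ (∑ (suc n) g ⊕ ∑ (suc n) h)
      ≈⟨ ⊕-cong (≈-reflexive (cong (_· Y 0) constant-term)) (≈-sym (∑-⊕ (suc n) g h)) ⟩
    b (suc n) 0 · Y 0 ⊕ (∑[ j < suc n ] (g j ⊕ h j))
      ≈⟨ ⊕-congˡ (b (suc n) 0 · Y 0) (∑-cong (suc n) λ j _ →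
           ≈-trans (·-distribʳ _ _ (Y (suc j))) (≈-reflexive (cong (_· Y (suc j)) (pascal n j w)))) ⟩
    ∑[ j < suc (suc n) ] b (suc n) j · Y j ∎
    where
    open ≈-Reasoning
    w : Carrier
    w = v - u
    b : ℕ → ℕ → Carrier
    b n j = binomialCoeff n j w
    Y f g h : ℕ → Poly
    Y j = [X- v ]^ j * 1ₚ
    f j = b n j · Y j
    g j = b n j · Y (suc j)
    h j = (w * b n (suc j)) · Y (suc j)
    raised : [X- v ]* ∑ (suc n) f ≈ ∑ (suc n) g
    raised = ≈-trans ([X-]*-∑ v (suc n) f) (∑-cong (suc n) λ j _ → [X-]*-· v (b n j) (Y j))
    h-top-vanishes : IsZero (h n)
    h-top-vanishes i = trans (coeff-· _ (Y (suc n)) i)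
      (trans (cong (λ x → w * x * coeff (Y (suc n)) i) (binomialCoeff-vanishes w (ℕ.n<1+n n)))
      (solve 2 (λ w y → w :* con (ℤ.+ 0) :* y := con (ℤ.+ 0)) refl w (coeff (Y (suc n)) i)))
    scaled : w · ∑ (suc n) f ≈ (w * b n 0) · Y 0 ⊕ ∑ (suc n) h
    scaled = ≈-trans (·-∑ w (suc n) f) (≈-trans (∑-cong (suc n) λ j _ → ·-assoc w (b n j) (Y j))
      (⊕-congˡ ((w * b n 0) · Y 0) (≈-sym (≈-trans (∑-last n h) (⊕-zeroʳ (∑ n h) h-top-vanishes)))))
    constant-term : w * b n 0 ≡ b (suc n) 0
    constant-term = solve 3 (λ w o x → w :* (o :* x) := o :* (w :* x)) refl w (1 × 1#) (w ^ n)

module Interpolation (F : FiniteField) where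

  open FieldArithmetic F
  open Polynomials F
  open import Data.Nat as ℕ using (ℕ; zero; suc; _≤_; z≤n; s≤s)
  import Data.Nat.Properties as ℕ
  open import Data.List using (List; []; _∷_; length)
  open import Data.List.Relation.Unary.All as All using (All)
  open import Data.List.Relation.Unary.AllPairs using (_∷_)
  open import Data.List.Relation.Unary.Unique.Propositional using (Unique)
  open import Data.Product using (∃; _,_; proj₁; proj₂)
  open import Relation.Binary.PropositionalEquality
  open import Relation.Nullary using (¬_; yes; no; contradiction)
  open import Function using (_∘_)
  import Data.Integer as ℤ

  eval : Poly → Carrier → Carrier
  eval [] y = 0#
  eval (a ∷ p) y = a + y * eval p y

  eval-zero : ∀ p y → IsZero p → eval p y ≡ 0#
  eval-zero [] y _ = refl
  eval-zero (a ∷ p) y p≡0 = trans (cong₂ (λ a e → a + y * e) (p≡0 0) (eval-zero p y (p≡0 ∘ suc)))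
    (solve 1 (λ y → con (ℤ.+ 0) :+ y :* con (ℤ.+ 0) := con (ℤ.+ 0)) refl y)

  eval-⊕ : ∀ p q y → eval (p ⊕ q) y ≡ eval p y + eval q y
  eval-⊕ [] q y = sym (+-identityˡ _)
  eval-⊕ (a ∷ p) [] y = sym (+-identityʳ _)
  eval-⊕ (a ∷ p) (b ∷ q) y = trans (cong (λ e → a + b + y * e) (eval-⊕ p q y))
    (solve 5 (λ a b y u v → a :+ b :+ y :* (u :+ v) := (a :+ y :* u) :+ (b :+ y :* v)) refl a b y (eval p y) (eval q y))

  eval-· : ∀ c p y → eval (c · p) y ≡ c * eval p y
  eval-· c [] y = sym (zeroʳ c)
  eval-· c (a ∷ p) y = trans (cong (λ e → c * a + y * e) (eval-· c p y))
    (solve 4 (λ c a y u → c :* a :+ y :* (c :* u) := c :* (a :+ y :* u)) refl c a y (eval p y))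

  eval-[X-]* : ∀ c p y → eval ([X- c ]* p) y ≡ (y - c) * eval p y
  eval-[X-]* c p y = begin
    eval ((0# ∷ p) ⊕ (- c) · p) y
      ≡⟨ eval-⊕ (0# ∷ p) ((- c) · p) y ⟩
    (0# + y * eval p y) + eval ((- c) · p) y
      ≡⟨ cong (0# + y * eval p y +_) (eval-· (- c) p y) ⟩
    (0# + y * eval p y) + (- c) * eval p y
      ≡⟨ solve 3 (λ c y e → (con (ℤ.+ 0) :+ y :* e) :+ (:- c) :* e := (y :- c) :* e) refl c y (eval p y) ⟩
    (y - c) * eval p y ∎
    where open ≡-Reasoning

  eval-[X-]^ : ∀ c n y → eval ([X- c ]^ n * 1ₚ) y ≡ (y - c) ^ n
  eval-[X-]^ c zero y = trans (cong (1# +_) (zeroʳ y)) (+-identityʳ 1#)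
  eval-[X-]^ c (suc n) y = trans (eval-[X-]* c ([X- c ]^ n * 1ₚ) y) (cong ((y - c) *_) (eval-[X-]^ c n y))

  eval-deg<1 : ∀ p y → p deg< 1 → eval p y ≡ coeff p 0
  eval-deg<1 [] y _ = refl
  eval-deg<1 (a ∷ p) y p<1 = trans (cong (λ e → a + y * e) (eval-zero p y λ i → p<1 (suc i) (s≤s z≤n)))
    (trans (cong (a +_) (zeroʳ y)) (+-identityʳ a))

  -- Synthetic division by X - b.
  quotient : Carrier → Poly → Poly
  quotient b [] = []
  quotient b (a ∷ p) = eval p b ∷ quotient b p

  eval-quotient : ∀ b p y → eval p y ≡ (y - b) * eval (quotient b p) y + eval p b
  eval-quotient b [] y = solve 2 (λ y b → con (ℤ.+ 0) := (y :- b) :* con (ℤ.+ 0) :+ con (ℤ.+ 0)) refl y b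
  eval-quotient b (a ∷ p) y = trans (cong (λ e → a + y * e) (eval-quotient b p y))
    (solve 5 (λ a b y q e → a :+ y :* ((y :- b) :* q :+ e) := (y :- b) :* (e :+ y :* q) :+ (a :+ b :* e)) refl a b y (eval (quotient b p) y) (eval p b))

  coeff-quotient : ∀ b p i → coeff p (suc i) ≡ coeff (quotient b p) i - b * coeff (quotient b p) (suc i)
  coeff-quotient b [] i = solve 1 (λ b → con (ℤ.+ 0) := con (ℤ.+ 0) :- b :* con (ℤ.+ 0)) refl b
  coeff-quotient b (a ∷ []) zero = solve 1 (λ b → con (ℤ.+ 0) := con (ℤ.+ 0) :- b :* con (ℤ.+ 0)) refl b
  coeff-quotient b (a ∷ a′ ∷ p) zero = solve 3 (λ a′ b e → a′ := (a′ :+ b :* e) :- b :* e) refl a′ b (eval p b)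
  coeff-quotient b (a ∷ p) (suc i) = coeff-quotient b p i

  quotient-deg< : ∀ b p n → p deg< suc n → quotient b p deg< n
  quotient-deg< b p n p<1+n = deg<-by-recurrence (quotient b p) b n λ i n≤i →
    x-y≡0⇒x≡y (trans (sym (coeff-quotient b p i)) (p<1+n (suc i) (s≤s n≤i)))

  coeff-quotient-top : ∀ b p n → p deg< suc (suc n) → coeff p (suc n) ≡ coeff (quotient b p) n
  coeff-quotient-top b p n p<2+n = begin
    coeff p (suc n)
      ≡⟨ coeff-quotient b p n ⟩
    coeff q n - b * coeff q (suc n)
      ≡⟨ cong (λ x → coeff q n - b * x) (quotient-deg< b p (suc n) p<2+n (suc n) ℕ.≤-refl) ⟩
    coeff q n - b * 0#
      ≡⟨ solve 2 (λ x b → x :- b :* con (ℤ.+ 0) := x) refl (coeff q n) b ⟩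
    coeff q n ∎
    where
    open ≡-Reasoning
    q : Poly
    q = quotient b p

  coeff-by-evaluations : ∀ M (B : List Carrier) → Unique B → length B ≡ suc M →
    ∃ λ (w : Carrier → Carrier) → ∀ p → p deg< suc M → sumOn B (λ y → w y * eval p y) ≡ coeff p M
  coeff-by-evaluations zero (b ∷ []) _ refl = (λ _ → 1#) , λ p p<1 →
    trans (+-identityʳ _) (trans (*-identityˡ _) (eval-deg<1 p b p<1))
  coeff-by-evaluations (suc M) (b ∷ B) (b∉B ∷ B-unique) |B|≡1+M = w , coeff-by-evaluations-suc
    where
    w′ : Carrier → Carrier
    w′ = proj₁ (coeff-by-evaluations M B B-unique (ℕ.suc-injective |B|≡1+M))

    w′-correct : ∀ p → p deg< suc M → sumOn B (λ y → w′ y * eval p y) ≡ coeff p M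
    w′-correct = proj₂ (coeff-by-evaluations M B B-unique (ℕ.suc-injective |B|≡1+M))

    -- Writing p = (X - b) q + p(b), the top coefficient of p is that of q and
    -- q(y) = (p(y) - p(b)) / (y - b) for y ≠ b.
    v : Carrier → Carrier
    v y = w′ y * (y - b) ⁻¹

    w : Carrier → Carrier
    w y with y ≟ b
    ... | yes _ = - sumOn B v
    ... | no _ = v y

    w-b : w b ≡ - sumOn B v
    w-b with b ≟ b
    ... | yes _ = refl
    ... | no b≢b = contradiction refl b≢b

    w-B : All (λ y → w y ≡ v y) B
    w-B = All.map w-other b∉B
      where
      w-other : ∀ {y} → ¬ b ≡ y → w y ≡ v y
      w-other {y} b≢y with y ≟ b
      ... | yes y≡b = contradiction (sym y≡b) b≢y
      ... | no _ = refl

    module _ (p : Poly) (p<M+2 : p deg< suc (suc M)) where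
      q : Poly
      q = quotient b p

      divided-difference : ∀ {y} → ¬ b ≡ y → v y * (eval p y - eval p b) ≡ w′ y * eval q y
      divided-difference {y} b≢y = begin
        v y * (eval p y - eval p b)
          ≡⟨ cong (λ e → v y * (e - eval p b)) (eval-quotient b p y) ⟩
        w′ y * (y - b) ⁻¹ * ((y - b) * eval q y + eval p b - eval p b)
          ≡⟨ solve 5 (λ w i d e r → w :* i :* (d :* e :+ r :- r) := w :* (i :* d) :* e) refl (w′ y) ((y - b) ⁻¹) (y - b) (eval q y) (eval p b) ⟩
        w′ y * ((y - b) ⁻¹ * (y - b)) * eval q y
          ≡⟨ cong (λ x → w′ y * x * eval q y) (⁻¹-inverseˡ (x≢y⇒x-y≢0 (b≢y ∘ sym))) ⟩
        w′ y * 1# * eval q y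
          ≡⟨ cong (_* eval q y) (*-identityʳ (w′ y)) ⟩
        w′ y * eval q y ∎
        where open ≡-Reasoning

      coeff-by-evaluations-suc : sumOn (b ∷ B) (λ y → w y * eval p y) ≡ coeff p (suc M)
      coeff-by-evaluations-suc = begin
        w b * eval p b + sumOn B (λ y → w y * eval p y)
          ≡⟨ cong₂ _+_ (cong (_* eval p b) w-b) (sumOn-cong B (All.map (cong (_* eval p _)) w-B)) ⟩
        - sumOn B v * eval p b + sumOn B (λ y → v y * eval p y)
          ≡⟨ solve 3 (λ s e t → :- s :* e :+ t := t :- s :* e) refl (sumOn B v) (eval p b) (sumOn B (λ y → v y * eval p y)) ⟩
        sumOn B (λ y → v y * eval p y) - sumOn B v * eval p b
          ≡⟨ sumOn-*-sub B v (eval p) (eval p b) ⟨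
        sumOn B (λ y → v y * (eval p y - eval p b))
          ≡⟨ sumOn-cong B (All.map divided-difference b∉B) ⟩
        sumOn B (λ y → w′ y * eval q y)
          ≡⟨ w′-correct q (quotient-deg< b p (suc M) p<M+2) ⟩
        coeff q M
          ≡⟨ coeff-quotient-top b p M p<M+2 ⟨
        coeff p (suc M) ∎
        where open ≡-Reasoning

module RootMultiplicity (F : FiniteField) where

  open FieldArithmetic F
  open Polynomials F
  open import Data.Nat as ℕ using (ℕ; zero; suc; _∸_; _<_; _≤_; z≤n; s≤s)
  import Data.Nat.Properties as ℕ
  open import Data.List using (List; []; _∷_; length)
  open import Data.List.Relation.Unary.All as All using (All; []; _∷_)
  open import Data.List.Relation.Unary.AllPairs using ([]; _∷_)
  open import Data.List.Relation.Unary.Unique.Propositional using (Unique)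
  open import Data.Product using (∃; _,_; proj₁; proj₂)
  open import Relation.Binary.PropositionalEquality
  open import Relation.Nullary using (¬_; contradiction)
  open import Function using (_∘_)
  import Data.Integer as ℤ

  infix 4 [X-_]^_∣_
  [X-_]^_∣_ : Carrier → ℕ → Poly → Set
  [X- a ]^ μ ∣ P = ∃ λ G → P ≈ [X- a ]^ μ * G

  ∣-resp-≈ : ∀ {a μ P P′} → P ≈ P′ → [X- a ]^ μ ∣ P → [X- a ]^ μ ∣ P′
  ∣-resp-≈ P≈P′ (G , P≈) = G , ≈-trans (≈-sym P≈P′) P≈

  IsZero-resp-≈ : ∀ {P P′} → P ≈ P′ → IsZero P → IsZero P′
  IsZero-resp-≈ P≈P′ P≡0 i = trans (sym (coeff-cong P≈P′ i)) (P≡0 i)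

  deg<-resp-≈ : ∀ {P P′ n} → P ≈ P′ → P deg< n → P′ deg< n
  deg<-resp-≈ P≈P′ P<n i n≤i = trans (sym (coeff-cong P≈P′ i)) (P<n i n≤i)

  [X-]*-recurrence : ∀ c G i → coeff ([X- c ]* G) (suc i) ≡ 0# → coeff G i ≡ c * coeff G (suc i)
  [X-]*-recurrence c G i vanishes = x-y≡0⇒x≡y (trans (sym (coeff-[X-]* c G (suc i))) vanishes)

  [X-]*-zero⁻¹ : ∀ c G → IsZero ([X- c ]* G) → IsZero G
  [X-]*-zero⁻¹ c G zero′ i = deg<-by-recurrence G c 0 (λ i _ → [X-]*-recurrence c G i (zero′ (suc i))) i z≤n

  [X-]*-deg<⁻¹ : ∀ c G n → [X- c ]* G deg< n → G deg< n ∸ 1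
  [X-]*-deg<⁻¹ c G n G<n = deg<-by-recurrence G c (n ∸ 1) λ i n-1≤i →
    [X-]*-recurrence c G i (G<n (suc i) (ℕ.≤-trans (ℕ.m≤n+m∸n n 1) (s≤s n-1≤i)))

  [X-]^-deg<⁻¹ : ∀ c μ G n → [X- c ]^ μ * G deg< n → G deg< n ∸ μ
  [X-]^-deg<⁻¹ c zero G n G<n = G<n
  [X-]^-deg<⁻¹ c (suc μ) G n G<n =
    subst (G deg<_) (ℕ.∸-+-assoc n 1 μ) ([X-]^-deg<⁻¹ c μ G (n ∸ 1) ([X-]*-deg<⁻¹ c ([X- c ]^ μ * G) n G<n))

  [X-]*-cancel : ∀ c {R R′} → [X- c ]* R ≈ [X- c ]* R′ → R ≈ R′
  [X-]*-cancel c {R} {R′} eq = ⊖-zero⇒≈ ([X-]*-zero⁻¹ c (R ⊖ R′) λ i →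
    trans (coeff-cong ([X-]*-⊖ c R R′) i) (trans (coeff-⊖ ([X- c ]* R) _ i)
      (trans (cong (_- coeff ([X- c ]* R′) i) (coeff-cong eq i)) (-‿inverseʳ _))))

  [X-]*-zero : ∀ c G → IsZero G → IsZero ([X- c ]* G)
  [X-]*-zero c G G≡0 i = trans (coeff-[X-]* c G i) (trans (cong₂ (λ x y → x - c * y) (shifted i) (G≡0 i))
    (solve 1 (λ c → con (ℤ.+ 0) :- c :* con (ℤ.+ 0) := con (ℤ.+ 0)) refl c))
    where
    shifted : ∀ i → coeff (0# ∷ G) i ≡ 0#
    shifted zero = refl
    shifted (suc i) = G≡0 i

  [X-]^-zero : ∀ c μ G → IsZero G → IsZero ([X- c ]^ μ * G)
  [X-]^-zero c zero G G≡0 = G≡0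
  [X-]^-zero c (suc μ) G G≡0 = [X-]*-zero c ([X- c ]^ μ * G) ([X-]^-zero c μ G G≡0)

  -- H = (X - a′) H₁ with H₁ = ((X - a′) ^ (j - 1) K - H) / (a′ - a).
  [X-]^-coprime-divisor₁ : ∀ {a a′} → ¬ a ≡ a′ → ∀ j K H → [X- a′ ]^ j * K ≈ [X- a ]* H → [X- a′ ]^ j ∣ H
  [X-]^-coprime-divisor₁ a≢a′ zero K H _ = H , ≈-refl
  [X-]^-coprime-divisor₁ {a} {a′} a≢a′ (suc j) K H eq = G , ≈-trans H≈ ([X-]*-cong a′ H₁≈)
    where
    δ : Carrier
    δ = a′ - a
    K′ H₁ : Poly
    K′ = [X- a′ ]^ j * K
    H₁ = δ ⁻¹ · (K′ ⊖ H)
    H≈ : H ≈ [X- a′ ]* H₁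
    H≈ = ≈-sym (begin
      [X- a′ ]* δ ⁻¹ · (K′ ⊖ H)                        ≈⟨ [X-]*-· a′ (δ ⁻¹) (K′ ⊖ H) ⟩
      δ ⁻¹ · [X- a′ ]* (K′ ⊖ H)                        ≈⟨ ·-congʳ (δ ⁻¹) ([X-]*-⊖ a′ K′ H) ⟩
      δ ⁻¹ · ([X- a′ ]* K′ ⊖ [X- a′ ]* H)               ≈⟨ ·-congʳ (δ ⁻¹) (⊖-cong eq ≈-refl) ⟩
      δ ⁻¹ · ([X- a ]* H ⊖ [X- a′ ]* H)                 ≈⟨ ·-congʳ (δ ⁻¹) (⊖-cong ([X-]*-recentre a a′ H) ≈-refl) ⟩
      δ ⁻¹ · (([X- a′ ]* H ⊕ δ · H) ⊖ [X- a′ ]* H)      ≈⟨ ·-congʳ (δ ⁻¹) (⊕-⊖-cancel ([X- a′ ]* H) (δ · H)) ⟩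
      δ ⁻¹ · δ · H                                     ≈⟨ ·-assoc (δ ⁻¹) δ H ⟩
      (δ ⁻¹ * δ) · H                                   ≈⟨ ≈-reflexive (cong (_· H) (⁻¹-inverseˡ (x≢y⇒x-y≢0 (a≢a′ ∘ sym)))) ⟩
      1# · H                                           ≈⟨ ·-identityˡ H ⟩
      H                                                ∎)
      where open ≈-Reasoning
    K′≈ : K′ ≈ [X- a ]* H₁
    K′≈ = [X-]*-cancel a′ (≈-trans eq (≈-trans ([X-]*-cong a H≈) ([X-]*-comm a a′ H₁)))
    G : Poly
    G = proj₁ ([X-]^-coprime-divisor₁ a≢a′ j K H₁ K′≈)
    H₁≈ : H₁ ≈ [X- a′ ]^ j * G
    H₁≈ = proj₂ ([X-]^-coprime-divisor₁ a≢a′ j K H₁ K′≈)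

  [X-]^-coprime-divisor : ∀ {a a′} → ¬ a ≡ a′ → ∀ μ ν G → [X- a′ ]^ μ ∣ [X- a ]^ ν * G → [X- a′ ]^ μ ∣ G
  [X-]^-coprime-divisor a≢a′ μ zero G a′∣ = a′∣
  [X-]^-coprime-divisor a≢a′ μ (suc ν) G (K , eq) =
    [X-]^-coprime-divisor a≢a′ μ ν G ([X-]^-coprime-divisor₁ a≢a′ μ K _ (≈-sym eq))

  roots-bound : ∀ μ (L : List Carrier) → Unique L → ∀ P n → ¬ IsZero P → P deg< n →
    All (λ a → [X- a ]^ μ ∣ P) L → μ ℕ.* length L < n
  roots-bound μ [] _ P zero P≢0 P<0 _ = contradiction (λ i → P<0 i z≤n) P≢0
  roots-bound μ [] _ P (suc n) _ _ _ = subst (_< suc n) (sym (ℕ.*-zeroʳ μ)) (s≤s z≤n)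
  roots-bound μ (a ∷ L) (a∉L ∷ L-unique) P n P≢0 P<n ((G , P≈) ∷ L∣P) =
    subst (_< n) (sym (ℕ.*-suc μ (length L))) (m<n∸o⇒o+m<n μ n bound)
    where
    G≢0 : ¬ IsZero G
    G≢0 G≡0 = P≢0 (IsZero-resp-≈ (≈-sym P≈) ([X-]^-zero a μ G G≡0))
    G<n-μ : G deg< n ∸ μ
    G<n-μ = [X-]^-deg<⁻¹ a μ G n (deg<-resp-≈ P≈ P<n)
    L∣G : All (λ a′ → [X- a′ ]^ μ ∣ G) L
    L∣G = All.zipWith (λ {a′} (a≢a′ , a′∣P) → [X-]^-coprime-divisor a≢a′ μ μ G (∣-resp-≈ {a′} {μ} P≈ a′∣P))
            (a∉L , L∣P)
    bound : μ ℕ.* length L < n ∸ μ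
    bound = roots-bound μ L L-unique G (n ∸ μ) G≢0 G<n-μ L∣G
    m<n∸o⇒o+m<n : ∀ {m} o n → m < n ∸ o → o ℕ.+ m < n
    m<n∸o⇒o+m<n zero n m<n = m<n
    m<n∸o⇒o+m<n (suc o) (suc n) m<n∸o = s≤s (m<n∸o⇒o+m<n o n m<n∸o)

module Stepanov (F : FiniteField) where

  open FieldArithmetic F
  open Polynomials F
  open BinomialExpansion F
  open Interpolation F
  open RootMultiplicity F
  open import Data.Nat as ℕ using (ℕ; zero; suc; _∸_; _<_; _≤_; z≤n; s≤s)
  import Data.Nat.Properties as ℕ
  open import Data.Nat.Combinatorics using (_C_; nCn≡1)
  open import Data.List using (List; _∷_; length; map; take)
  open import Data.List.Properties using (length-map; length-take)
  open import Data.List.Membership.Propositional using (_∈_)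
  open import Data.List.Relation.Unary.All as All using (All)
  open import Data.List.Relation.Unary.Any using (here; there)
  open import Data.List.Relation.Unary.Unique.Propositional using (Unique)
  import Data.List.Relation.Unary.Unique.Propositional.Properties as Unique
  open import Data.Product using (_,_; proj₁; proj₂)
  open import Relation.Binary.PropositionalEquality
  open import Relation.Nullary using (¬_; Dec; yes; no)
  import Data.Integer as ℤ

  -- Stepanov's auxiliary polynomial ∑ ν x (X - x) ^ (k + M) - 1 on M + 1
  -- points x; the weights ν make its coefficients above degree k vanish.
  module AuxiliaryPolynomial (k : ℕ) (1≤k : 1 ≤ k) (M′ : ℕ)
    (S′ : List Carrier) (S′-unique : Unique S′) (|S′|≡1+M : length S′ ≡ suc (suc M′)) where

    M E : ℕ
    M = suc M′
    E = k ℕ.+ M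

    private
      -‿injective : ∀ {x y} → - x ≡ - y → x ≡ y
      -‿injective {x} {y} eq = trans (sym (-‿involutive x)) (trans (cong -_ eq) (-‿involutive y))

      -S′-unique : Unique (map -_ S′)
      -S′-unique = Unique.map⁺ -‿injective S′-unique

      |-S′|≡1+M : length (map -_ S′) ≡ suc M
      |-S′|≡1+M = trans (length-map -_ S′) |S′|≡1+M

      w : Carrier → Carrier
      w = proj₁ (coeff-by-evaluations M (map -_ S′) -S′-unique |-S′|≡1+M)

      w-correct : ∀ p → p deg< suc M → sumOn (map -_ S′) (λ y → w y * eval p y) ≡ coeff p M
      w-correct = proj₂ (coeff-by-evaluations M (map -_ S′) -S′-unique |-S′|≡1+M)

    ν : Carrier → Carrier
    ν x = w (- x)

    moment : ∀ a m → m ≤ M → sumOn S′ (λ x → ν x * (a - x) ^ m) ≡ binomialCoeff m M (- (- a))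
    moment a m m≤M = begin
      sumOn S′ (λ x → ν x * (a - x) ^ m)
        ≡⟨ sumOn-cong S′ (All.tabulate λ {x} _ → cong (ν x *_) (sym (value x))) ⟩
      sumOn S′ (λ x → ν x * eval P (- x))
        ≡⟨ sumOn-map -_ S′ (λ y → w y * eval P y) ⟨
      sumOn (map -_ S′) (λ y → w y * eval P y)
        ≡⟨ w-correct P (λ i M<i → [X-]^-deg< (- a) m i (ℕ.≤-trans (s≤s m≤M) M<i)) ⟩
      coeff P M
        ≡⟨ coeff-[X-]^ (- a) m M ⟩
      binomialCoeff m M (- (- a)) ∎
      where
      open ≡-Reasoning
      P : Poly
      P = [X- - a ]^ m * 1ₚ
      value : ∀ x → eval P (- x) ≡ (a - x) ^ m
      value x = trans (eval-[X-]^ (- a) m (- x)) (cong (_^ m) (solve 2 (λ x a → :- x :- (:- a) := a :- x) refl x a))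

    moment-below : ∀ a {m} → m < M → sumOn S′ (λ x → ν x * (a - x) ^ m) ≡ 0#
    moment-below a {m} m<M = trans (moment a m (ℕ.<⇒≤ m<M)) (binomialCoeff-vanishes (- (- a)) m<M)

    moment-top : ∀ a → sumOn S′ (λ x → ν x * (a - x) ^ M) ≡ 1#
    moment-top a = begin
      sumOn S′ (λ x → ν x * (a - x) ^ M)       ≡⟨ moment a M ℕ.≤-refl ⟩
      (M C M) × 1# * (- (- a)) ^ (M ∸ M)       ≡⟨ cong₂ (λ m e → m × 1# * (- (- a)) ^ e) (nCn≡1 M) (ℕ.n∸n≡0 M) ⟩
      1 × 1# * 1#                              ≡⟨ trans (*-identityʳ _) (+-identityʳ 1#) ⟩
      1#                                       ∎
      where open ≡-Reasoning

    poly : Poly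
    poly = ∑[ x ∈ S′ ] ν x · [X- x ]^ E * 1ₚ ⊖ 1ₚ

    coeff-poly : ∀ i → coeff poly i ≡ (E C i) × 1# * sumOn S′ (λ x → ν x * (0# - x) ^ (E ∸ i)) - coeff 1ₚ i
    coeff-poly i = begin
      coeff poly i
        ≡⟨ coeff-⊖ (∑[ x ∈ S′ ] ν x · P x) 1ₚ i ⟩
      coeff (∑[ x ∈ S′ ] ν x · P x) i - coeff 1ₚ i
        ≡⟨ cong (_- coeff 1ₚ i) (coeff-∑ₗ S′ (λ x → ν x · P x) i) ⟩
      sumOn S′ (λ x → coeff (ν x · P x) i) - coeff 1ₚ i
        ≡⟨ cong (_- coeff 1ₚ i) (sumOn-cong S′ (All.tabulate λ {x} _ → term x)) ⟩
      sumOn S′ (λ x → (E C i) × 1# * (ν x * (0# - x) ^ (E ∸ i))) - coeff 1ₚ i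
        ≡⟨ cong (_- coeff 1ₚ i) (sumOn-*ˡ S′ ((E C i) × 1#) _) ⟨
      (E C i) × 1# * sumOn S′ (λ x → ν x * (0# - x) ^ (E ∸ i)) - coeff 1ₚ i ∎
      where
      open ≡-Reasoning
      P : Carrier → Poly
      P x = [X- x ]^ E * 1ₚ
      term : ∀ x → coeff (ν x · P x) i ≡ (E C i) × 1# * (ν x * (0# - x) ^ (E ∸ i))
      term x = begin
        coeff (ν x · P x) i
          ≡⟨ coeff-· (ν x) (P x) i ⟩
        ν x * coeff (P x) i
          ≡⟨ cong (ν x *_) (coeff-[X-]^ x E i) ⟩
        ν x * ((E C i) × 1# * (- x) ^ (E ∸ i))
          ≡⟨ cong (λ y → ν x * ((E C i) × 1# * y ^ (E ∸ i))) (+-identityˡ (- x)) ⟨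
        ν x * ((E C i) × 1# * (0# - x) ^ (E ∸ i))
          ≡⟨ solve 3 (λ v c y → v :* (c :* y) := c :* (v :* y)) refl (ν x) ((E C i) × 1#) ((0# - x) ^ (E ∸ i)) ⟩
        (E C i) × 1# * (ν x * (0# - x) ^ (E ∸ i)) ∎

    poly-deg< : poly deg< suc k
    poly-deg< zero ()
    poly-deg< (suc i) (s≤s k≤i) = begin
      coeff poly (suc i)
        ≡⟨ coeff-poly (suc i) ⟩
      (E C suc i) × 1# * sumOn S′ (λ x → ν x * (0# - x) ^ (E ∸ suc i)) - 0#
        ≡⟨ cong (λ y → (E C suc i) × 1# * y - 0#) (moment-below 0# (exponent-below k (suc i) (s≤s k≤i))) ⟩
      (E C suc i) × 1# * 0# - 0#
        ≡⟨ solve 1 (λ c → c :* con (ℤ.+ 0) :- con (ℤ.+ 0) := con (ℤ.+ 0)) refl ((E C suc i) × 1#) ⟩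
      0# ∎
      where
      open ≡-Reasoning
      exponent-below : ∀ k i → k < i → k ℕ.+ M ∸ i < M
      exponent-below zero (suc i) _ = s≤s (ℕ.m∸n≤m M′ i)
      exponent-below (suc k) (suc i) (s≤s k<i) = exponent-below k i k<i

    coeff-poly-k : coeff poly k ≡ (E C k) × 1#
    coeff-poly-k = begin
      coeff poly k
        ≡⟨ coeff-poly k ⟩
      (E C k) × 1# * sumOn S′ (λ x → ν x * (0# - x) ^ (E ∸ k)) - coeff 1ₚ k
        ≡⟨ cong₂ (λ y z → (E C k) × 1# * y - z) top (coeff-1ₚ-positive 1≤k) ⟩
      (E C k) × 1# * 1# - 0#
        ≡⟨ solve 2 (λ c o → c :* o :- con (ℤ.+ 0) := c :* o) refl ((E C k) × 1#) 1# ⟩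
      (E C k) × 1# * 1#
        ≡⟨ *-identityʳ _ ⟩
      (E C k) × 1# ∎
      where
      open ≡-Reasoning
      top : sumOn S′ (λ x → ν x * (0# - x) ^ (E ∸ k)) ≡ 1#
      top = trans (cong (λ e → sumOn S′ (λ x → ν x * (0# - x) ^ e)) (ℕ.m+n∸m≡n k M)) (moment-top 0#)
      coeff-1ₚ-positive : ∀ {i} → 1 ≤ i → coeff 1ₚ i ≡ 0#
      coeff-1ₚ-positive {suc i} _ = refl

    module _ (a : Carrier) (unit-differences : ∀ {x} → x ∈ S′ → ¬ a ≡ x → (a - x) ^ k ≡ 1#) where

      private
        -- (a - x) ^ k is 1, or both sides vanish as a = x.
        power-reduction : ∀ {x j} → x ∈ S′ → j < M → (a - x) ^ (E ∸ j) ≡ (a - x) ^ (M ∸ j)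
        power-reduction {x} {j} x∈S′ j<M = begin
          (a - x) ^ (E ∸ j)                   ≡⟨ cong ((a - x) ^_) (ℕ.+-∸-assoc k (ℕ.<⇒≤ j<M)) ⟩
          (a - x) ^ (k ℕ.+ (M ∸ j))           ≡⟨ ^-distribˡ-+-* (a - x) k (M ∸ j) ⟩
          (a - x) ^ k * (a - x) ^ (M ∸ j)     ≡⟨ cases (a ≟ x) ⟩
          (a - x) ^ (M ∸ j)                   ∎
          where
          open ≡-Reasoning
          cases : Dec (a ≡ x) → (a - x) ^ k * (a - x) ^ (M ∸ j) ≡ (a - x) ^ (M ∸ j)
          cases (no a≢x) = trans (cong (_* _) (unit-differences x∈S′ a≢x)) (*-identityˡ _)
          cases (yes refl) = begin
            (a - a) ^ k * (a - a) ^ (M ∸ j)   ≡⟨ cong (λ y → y ^ k * y ^ (M ∸ j)) (-‿inverseʳ a) ⟩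
            0# ^ k * 0# ^ (M ∸ j)             ≡⟨ cong (_* 0# ^ (M ∸ j)) (0^n≡0 1≤k) ⟩
            0# * 0# ^ (M ∸ j)                 ≡⟨ zeroˡ _ ⟩
            0#                                ≡⟨ 0^n≡0 (ℕ.m<n⇒0<n∸m j<M) ⟨
            0# ^ (M ∸ j)                      ≡⟨ cong (λ y → y ^ (M ∸ j)) (-‿inverseʳ a) ⟨
            (a - a) ^ (M ∸ j)                 ∎

        taylorCoeff : ℕ → Carrier
        taylorCoeff j = sumOn S′ (λ x → ν x * binomialCoeff E j (a - x))

        taylorCoeff-below : ∀ {j} → j < M → taylorCoeff j ≡ (E C j) × 1# * sumOn S′ (λ x → ν x * (a - x) ^ (M ∸ j))
        taylorCoeff-below {j} j<M = trans (sumOn-cong S′ (All.tabulate λ {x} x∈S′ → begin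
            ν x * ((E C j) × 1# * (a - x) ^ (E ∸ j))
              ≡⟨ cong (λ y → ν x * ((E C j) × 1# * y)) (power-reduction x∈S′ j<M) ⟩
            ν x * ((E C j) × 1# * (a - x) ^ (M ∸ j))
              ≡⟨ solve 3 (λ v c y → v :* (c :* y) := c :* (v :* y)) refl (ν x) ((E C j) × 1#) ((a - x) ^ (M ∸ j)) ⟩
            (E C j) × 1# * (ν x * (a - x) ^ (M ∸ j)) ∎))
          (sym (sumOn-*ˡ S′ ((E C j) × 1#) _))
          where open ≡-Reasoning

        taylorCoeff-0 : taylorCoeff 0 ≡ 1#
        taylorCoeff-0 = begin
          taylorCoeff 0                                                  ≡⟨ taylorCoeff-below (s≤s z≤n) ⟩
          1 × 1# * sumOn S′ (λ x → ν x * (a - x) ^ M)          ≡⟨ cong (1 × 1# *_) (moment-top a) ⟩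
          1 × 1# * 1#                                          ≡⟨ trans (*-identityʳ _) (+-identityʳ 1#) ⟩
          1#                                                   ∎
          where open ≡-Reasoning

        taylorCoeff-middle : ∀ j → suc j < M → taylorCoeff (suc j) ≡ 0#
        taylorCoeff-middle j 1+j<M = begin
          taylorCoeff (suc j)
            ≡⟨ taylorCoeff-below 1+j<M ⟩
          (E C suc j) × 1# * sumOn S′ (λ x → ν x * (a - x) ^ (M ∸ suc j))
            ≡⟨ cong ((E C suc j) × 1# *_) (moment-below a (ℕ.∸-monoʳ-< (s≤s z≤n) (ℕ.<⇒≤ 1+j<M))) ⟩
          (E C suc j) × 1# * 0#
            ≡⟨ zeroʳ _ ⟩
          0# ∎
          where open ≡-Reasoning

        Y : ℕ → Poly
        Y j = [X- a ]^ j * 1ₚ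

        lower-terms : ∑[ j < M ] taylorCoeff j · Y j ≈ 1ₚ
        lower-terms = ≈-trans (∑-head M′ (λ j → taylorCoeff j · Y j) middle≡0)
          (≈-trans (≈-reflexive (cong (_· 1ₚ) taylorCoeff-0)) (·-identityˡ 1ₚ))
          where
          middle≡0 : ∀ j → j < M′ → IsZero (taylorCoeff (suc j) · Y (suc j))
          middle≡0 j j<M′ i = trans (coeff-· (taylorCoeff (suc j)) (Y (suc j)) i)
            (trans (cong (_* coeff (Y (suc j)) i) (taylorCoeff-middle j (s≤s j<M′))) (zeroˡ _))

        G : Poly
        G = ∑[ j < suc k ] taylorCoeff (M ℕ.+ j) · Y j

        upper-terms : ∑[ j < suc k ] taylorCoeff (M ℕ.+ j) · Y (M ℕ.+ j) ≈ [X- a ]^ M * G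
        upper-terms = ≈-trans (∑-cong (suc k) λ j _ → ≈-trans (·-congʳ (taylorCoeff (M ℕ.+ j)) (≈-reflexive ([X-]^-+ a M j 1ₚ)))
                                                        (≈-sym ([X-]^-· a M (taylorCoeff (M ℕ.+ j)) (Y j))))
                       (≈-sym ([X-]^-∑ a M (suc k) (λ j → taylorCoeff (M ℕ.+ j) · Y j)))

      poly-divisible : [X- a ]^ M ∣ poly
      poly-divisible = G , (begin
        ∑[ x ∈ S′ ] ν x · [X- x ]^ E * 1ₚ ⊖ 1ₚ
          ≈⟨ ⊖-cong (∑ₗ-cong S′ λ x → ·-congʳ (ν x) ([X-]^-recentre x a E)) ≈-refl ⟩
        ∑[ x ∈ S′ ] ν x · (∑[ j < suc E ] binomialCoeff E j (a - x) · Y j) ⊖ 1ₚ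
          ≈⟨ ⊖-cong (∑ₗ-∑-comm S′ ν (suc E) (λ x j → binomialCoeff E j (a - x)) Y) ≈-refl ⟩
        ∑ (suc E) (λ j → taylorCoeff j · Y j) ⊖ 1ₚ
          ≡⟨ cong (λ n → ∑ n (λ j → taylorCoeff j · Y j) ⊖ 1ₚ) (trans (cong suc (ℕ.+-comm k M)) (sym (ℕ.+-suc M k))) ⟩
        ∑ (M ℕ.+ suc k) (λ j → taylorCoeff j · Y j) ⊖ 1ₚ
          ≈⟨ ⊖-cong (∑-split M (suc k) (λ j → taylorCoeff j · Y j)) ≈-refl ⟩
        (∑[ j < M ] taylorCoeff j · Y j ⊕ (∑[ j < suc k ] taylorCoeff (M ℕ.+ j) · Y (M ℕ.+ j))) ⊖ 1ₚ
          ≈⟨ ⊖-cong (⊕-cong lower-terms upper-terms) ≈-refl ⟩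
        (1ₚ ⊕ [X- a ]^ M * G) ⊖ 1ₚ
          ≈⟨ ⊕-⊖-cancel 1ₚ ([X- a ]^ M * G) ⟩
        [X- a ]^ M * G ∎)
        where open ≈-Reasoning

  ∈-take : ∀ {x : Carrier} n xs → x ∈ take n xs → x ∈ xs
  ∈-take (suc n) (y ∷ ys) (here x≡y) = here x≡y
  ∈-take (suc n) (y ∷ ys) (there x∈ys) = there (∈-take n ys x∈ys)

  stepanov : ∀ k M (S : List Carrier) → Unique S → 1 ≤ k → M < length S →
    ¬ ((k ℕ.+ M) C k) × 1# ≡ 0# →
    (∀ {x y} → x ∈ S → y ∈ S → ¬ x ≡ y → (x - y) ^ k ≡ 1#) →
    M ℕ.* length S ≤ k
  stepanov k zero S _ _ _ _ _ = z≤n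
  stepanov k M@(suc M′) S S-unique 1≤k M<|S| binomial≢0 unit-differences =
    ℕ.≤-pred (roots-bound M S S-unique poly (suc k) poly≢0 poly-deg< (All.tabulate λ a∈S →
      poly-divisible _ λ x∈S′ → unit-differences a∈S (∈-take (suc M) S x∈S′)))
    where
    |S′|≡1+M : length (take (suc M) S) ≡ suc M
    |S′|≡1+M = trans (length-take (suc M) S) (ℕ.m≤n⇒m⊓n≡m M<|S|)
    open AuxiliaryPolynomial k 1≤k M′ (take (suc M) S) (Unique.take⁺ (suc M) S-unique) |S′|≡1+M
      using (poly; poly-deg<; coeff-poly-k; poly-divisible)
    poly≢0 : ¬ IsZero poly
    poly≢0 poly≡0 = binomial≢0 (trans (sym coeff-poly-k) (poly≡0 k))

module FiniteFieldFacts (F : FiniteField) where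

  open FieldArithmetic F
  open import Level using (0ℓ)
  open import Data.Nat as ℕ using (ℕ; zero; suc; _≤_)
  import Data.Nat.Properties as ℕ
  open import Data.Fin as Fin using (Fin; punchIn)
  import Data.Fin.Properties as Fin
  open import Data.Vec.Functional using (Vector; removeAt)
  open import Data.List using (List; []; _∷_; length; lookup)
  open import Data.List.Membership.Propositional.Properties using (∈-lookup)
  open import Data.List.Relation.Unary.All as All using ([]; _∷_)
  open import Data.List.Relation.Unary.AllPairs using ([]; _∷_)
  open import Data.List.Relation.Unary.Unique.Propositional using (Unique)
  open import Data.Product using (∃; _,_)
  open import Function using (_∘_; _↔_; Inverse; mk↔ₛ′)
  open import Function.Properties.Inverse using (↔-sym; ↔⇒↣)
  open import Function.Bundles using (Injection)
  open import Function.Construct.Composition using (_↔-∘_)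
  open import Relation.Binary.PropositionalEquality
  open import Relation.Nullary using (¬_; yes; no; contradiction)
  open import Algebra.Bundles using (CommutativeMonoid)
  import Algebra.Properties.CommutativeMonoid.Sum as MonoidSum

  private
    module Σ⁺ = MonoidSum +-commutativeMonoid
    module Π = MonoidSum *-commutativeMonoid

  module Counting {n : ℕ} (enum : Carrier ↔ Fin (suc n)) where

    open Inverse enum using (to; from; strictlyInverseˡ; strictlyInverseʳ)

    sum-reindex : (M : CommutativeMonoid 0ℓ 0ℓ) (h : Carrier → CommutativeMonoid.Carrier M) (σ : Carrier ↔ Carrier) →
      let open CommutativeMonoid M in MonoidSum.sum M (h ∘ from) ≈ MonoidSum.sum M (h ∘ Inverse.to σ ∘ from)
    sum-reindex M h σ = M.trans (sum-permute (h ∘ from) (enum ↔-∘ (σ ↔-∘ ↔-sym enum)))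
      (M.reflexive (sum-cong-≗ {suc n} λ i → cong h (strictlyInverseʳ (Inverse.to σ (from i)))))
      where
      module M = CommutativeMonoid M
      open MonoidSum M using (sum-permute; sum-cong-≗)

    -- Translating by 1 permutes F, so ∑ x = ∑ (x + 1) = ∑ x + (n + 1) · 1.
    card×1≡0 : suc n × 1# ≡ 0#
    card×1≡0 = begin
      suc n × 1#               ≡⟨ solve 2 (λ s c → c := (s :+ c) :- s) refl S (suc n × 1#) ⟩
      (S + suc n × 1#) - S     ≡⟨ cong (λ t → (S + t) - S) (Σ⁺.sum-replicate (suc n)) ⟨
      (S + Σ⁺.sum {suc n} (λ _ → 1#)) - S ≡⟨ cong (_- S) (Σ⁺.∑-distrib-+ from (λ _ → 1#)) ⟨
      Σ⁺.sum (λ i → from i + 1#) - S ≡⟨ cong (_- S) (sum-reindex +-commutativeMonoid (λ x → x) translation) ⟨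
      S - S                    ≡⟨ -‿inverseʳ S ⟩
      0#                       ∎
      where
      open ≡-Reasoning
      S : Carrier
      S = Σ⁺.sum from
      translation : Carrier ↔ Carrier
      translation = mk↔ₛ′ (_+ 1#) (_- 1#)
        (λ x → solve 2 (λ x o → (x :- o) :+ o := x) refl x 1#)
        (λ x → solve 2 (λ x o → (x :+ o) :- o := x) refl x 1#)

    private
      nonzeroPart : Carrier → Carrier
      nonzeroPart x with x ≟ 0#
      ... | yes _ = 1#
      ... | no _ = x

      nonzeroPart-≢0 : ∀ x → ¬ nonzeroPart x ≡ 0#
      nonzeroPart-≢0 x with x ≟ 0#
      ... | yes _ = 1≢0
      ... | no x≢0 = x≢0

      product-≢0 : ∀ {m} (f : Vector Carrier m) → (∀ i → ¬ f i ≡ 0#) → ¬ Π.sum f ≡ 0#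
      product-≢0 {zero} f _ = 1≢0
      product-≢0 {suc m} f f≢0 = *-≢0 (f≢0 Fin.zero) (product-≢0 (f ∘ Fin.suc) (f≢0 ∘ Fin.suc))

      product-const : ∀ {m} (f : Vector Carrier m) {z} → (∀ i → f i ≡ z) → Π.sum f ≡ z ^ m
      product-const {zero} f _ = refl
      product-const {suc m} f f≡z = cong₂ _*_ (f≡z Fin.zero) (product-const (f ∘ Fin.suc) (f≡z ∘ Fin.suc))

    -- Scaling by z permutes F; comparing the products of the nonzero parts
    -- before and after shows that the product of z over the n nonzero
    -- elements is 1.
    fermat : ∀ {z} → ¬ z ≡ 0# → z ^ n ≡ 1#
    fermat {z} z≢0 = begin
      z ^ n
        ≡⟨ product-const (removeAt (χ ∘ from) (to 0#)) χ-nonzero ⟨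
      Π.sum (removeAt (χ ∘ from) (to 0#))
        ≡⟨ *-identityˡ _ ⟨
      1# * Π.sum (removeAt (χ ∘ from) (to 0#)) ≡⟨ cong (_* Π.sum (removeAt (χ ∘ from) (to 0#))) χ-zero ⟨
      χ (from (to 0#)) * Π.sum (removeAt (χ ∘ from) (to 0#)) ≡⟨ Π.sum-remove {i = to 0#} (χ ∘ from) ⟨
      Π.sum (χ ∘ from)
        ≡⟨ x*y≡y⇒x≡1 (product-≢0 (nonzeroPart ∘ from) (nonzeroPart-≢0 ∘ from)) invariance ⟩
      1# ∎
      where
      open ≡-Reasoning
      χ : Carrier → Carrier
      χ x with x ≟ 0#
      ... | yes _ = 1#
      ... | no _ = z

      χ-zero : χ (from (to 0#)) ≡ 1#
      χ-zero rewrite strictlyInverseʳ 0# with 0# ≟ 0#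
      ... | yes _ = refl
      ... | no 0≢0 = contradiction refl 0≢0

      χ-nonzero : ∀ j → χ (from (punchIn (to 0#) j)) ≡ z
      χ-nonzero j with from (punchIn (to 0#) j) ≟ 0#
      ... | yes x≡0 = contradiction (trans (sym (strictlyInverseˡ _)) (cong to x≡0)) (Fin.punchInᵢ≢i (to 0#) j)
      ... | no _ = refl

      nonzeroPart-scaling : ∀ x → nonzeroPart (z * x) ≡ χ x * nonzeroPart x
      nonzeroPart-scaling x with x ≟ 0# | z * x ≟ 0#
      ... | yes _ | yes _ = sym (*-identityˡ 1#)
      ... | yes refl | no zx≢0 = contradiction (zeroʳ z) zx≢0
      ... | no x≢0 | yes zx≡0 = contradiction zx≡0 (*-≢0 z≢0 x≢0)
      ... | no _ | no _ = refl

      scaling : Carrier ↔ Carrier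
      scaling = mk↔ₛ′ (z *_) (z ⁻¹ *_)
        (λ x → trans (sym (*-assoc _ _ _)) (trans (cong (_* x) (⁻¹-inverseʳ z≢0)) (*-identityˡ x)))
        (λ x → trans (sym (*-assoc _ _ _)) (trans (cong (_* x) (⁻¹-inverseˡ z≢0)) (*-identityˡ x)))

      invariance : Π.sum (χ ∘ from) * Π.sum (nonzeroPart ∘ from) ≡ Π.sum (nonzeroPart ∘ from)
      invariance = begin
        Π.sum (χ ∘ from) * Π.sum (nonzeroPart ∘ from)     ≡⟨ Π.∑-distrib-+ (χ ∘ from) (nonzeroPart ∘ from) ⟨
        Π.sum (λ i → χ (from i) * nonzeroPart (from i))   ≡⟨ Π.sum-cong-≗ (λ i → nonzeroPart-scaling (from i)) ⟨
        Π.sum (λ i → nonzeroPart (z * from i))            ≡⟨ sum-reindex *-commutativeMonoid nonzeroPart scaling ⟨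
        Π.sum (nonzeroPart ∘ from)                        ∎

      x*y≡y⇒x≡1 : ∀ {x y} → ¬ y ≡ 0# → x * y ≡ y → x ≡ 1#
      x*y≡y⇒x≡1 {x} {y} y≢0 xy≡y = x-y≡0⇒x≡y (x*y≡0⇒y≡0 y≢0 (begin
        y * (x - 1#)      ≡⟨ solve 3 (λ y x o → y :* (x :- o) := x :* y :- y :* o) refl y x 1# ⟩
        x * y - y * 1#    ≡⟨ cong₂ _-_ xy≡y (*-identityʳ y) ⟩
        y - y             ≡⟨ -‿inverseʳ y ⟩
        0#                ∎))

  private
    nonempty : ∀ {m} → Fin m → ∃ λ n → m ≡ suc n
    nonempty {suc n} _ = n , refl

    enumerationOfSize : ∀ {n} → size ≡ suc n → Carrier ↔ Fin (suc n)
    enumerationOfSize size≡1+n = subst (λ m → Carrier ↔ Fin m) size≡1+n enumeration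

  size×1≡0 : size × 1# ≡ 0#
  size×1≡0 with nonempty (Inverse.to enumeration 0#)
  ... | n , size≡1+n = trans (cong (_× 1#) size≡1+n) (Counting.card×1≡0 (enumerationOfSize size≡1+n))

  fermat : ∀ {n z} → size ≡ suc n → ¬ z ≡ 0# → z ^ n ≡ 1#
  fermat size≡1+n = Counting.fermat (enumerationOfSize size≡1+n)

  -- (p · 1) ^ s = q · 1 = 0 and F has no zero divisors.
  characteristic : ∀ {p s} → size ≡ p ℕ.^ s → p × 1# ≡ 0#
  characteristic {p} {s} size≡pˢ with p × 1# ≟ 0#
  ... | yes p×1≡0 = p×1≡0
  ... | no p×1≢0 = contradiction (trans (sym (×1-homo-^ p s)) (trans (cong (_× 1#) (sym size≡pˢ)) size×1≡0)) (^-≢0 s p×1≢0)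

  length≤size : ∀ {xs : List Carrier} → Unique xs → length xs ≤ size
  length≤size {xs} xs-unique with length xs ℕ.≤? size
  ... | yes |xs|≤size = |xs|≤size
  ... | no |xs|≰size with Fin.pigeonhole (ℕ.≰⇒> |xs|≰size) (Inverse.to enumeration ∘ lookup xs)
  ... | i , j , i<j , same-image =
    contradiction (lookup-injective xs xs-unique (Injection.injective (↔⇒↣ enumeration) same-image)) (Fin.<⇒≢ i<j)
    where
    lookup-injective : ∀ xs → Unique xs → ∀ {i j} → lookup xs i ≡ lookup xs j → i ≡ j
    lookup-injective (x ∷ xs) (_ ∷ _) {Fin.zero} {Fin.zero} _ = refl
    lookup-injective (x ∷ xs) (x∉xs ∷ _) {Fin.zero} {Fin.suc j} x≡ = contradiction x≡ (All.lookup x∉xs (∈-lookup j))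
    lookup-injective (x ∷ xs) (x∉xs ∷ _) {Fin.suc i} {Fin.zero} ≡x = contradiction (sym ≡x) (All.lookup x∉xs (∈-lookup i))
    lookup-injective (x ∷ xs) (_ ∷ xs-unique) {Fin.suc i} {Fin.suc j} eq = cong Fin.suc (lookup-injective xs xs-unique eq)

  2≤size : 2 ≤ size
  2≤size = length≤size {0# ∷ 1# ∷ []} ((0≢1 ∷ []) ∷ ([] ∷ []))

module BaseDigits (b : ℕ) .{{_ : NonZero b}} where

  open import Data.Nat.Base using (zero; suc; _+_; _*_; _^_; _∸_; _⊓_; _≤_; _<_; z≤n; s≤s; >-nonZero⁻¹)
  open import Data.Nat.DivMod using (_/_; _%_; m≡m%n+[m/n]*n; m%n<n; m<n*o⇒m/o<n)
  import Data.Nat.Properties as ℕ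
  open import Relation.Binary.PropositionalEquality
  open import Data.Nat.Solver using (module +-*-Solver)
  open +-*-Solver

  repunit : ℕ → ℕ
  repunit zero = 0
  repunit (suc j) = 1 + b * repunit j

  -- The number whose j lowest base-b digits are those of t, each capped at c.
  capDigits : ℕ → ℕ → ℕ → ℕ
  capDigits c zero t = 0
  capDigits c (suc j) t = b * capDigits c j (t / b) + (t % b) ⊓ c

  [b∸1]*repunit+1≡b^ : ∀ j → (b ∸ 1) * repunit j + 1 ≡ b ^ j
  [b∸1]*repunit+1≡b^ zero = cong (_+ 1) (ℕ.*-zeroʳ (b ∸ 1))
  [b∸1]*repunit+1≡b^ (suc j) = begin
    (b ∸ 1) * (1 + b * repunit j) + 1
      ≡⟨ solve 3 (λ x b r → x :* (con 1 :+ b :* r) :+ con 1 := b :* (x :* r) :+ (x :+ con 1)) refl (b ∸ 1) b (repunit j) ⟩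
    b * ((b ∸ 1) * repunit j) + ((b ∸ 1) + 1)
      ≡⟨ cong (b * ((b ∸ 1) * repunit j) +_) (ℕ.m∸n+n≡m (>-nonZero⁻¹ b)) ⟩
    b * ((b ∸ 1) * repunit j) + b
      ≡⟨ solve 2 (λ b y → b :* y :+ b := b :* (y :+ con 1)) refl b ((b ∸ 1) * repunit j) ⟩
    b * ((b ∸ 1) * repunit j + 1)
      ≡⟨ cong (b *_) ([b∸1]*repunit+1≡b^ j) ⟩
    b * b ^ j ∎
    where open ≡-Reasoning

  capDigits-≤ : ∀ c j t → capDigits c j t ≤ t
  capDigits-≤ c zero t = z≤n
  capDigits-≤ c (suc j) t = begin
    b * capDigits c j (t / b) + (t % b) ⊓ c    ≤⟨ ℕ.+-mono-≤ (ℕ.*-monoʳ-≤ b (capDigits-≤ c j (t / b))) (ℕ.m⊓n≤m (t % b) c) ⟩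
    b * (t / b) + t % b                        ≡⟨ solve 3 (λ b q r → b :* q :+ r := r :+ q :* b) refl b (t / b) (t % b) ⟩
    t % b + t / b * b                          ≡⟨ m≡m%n+[m/n]*n t b ⟨
    t                                          ∎
    where open ℕ.≤-Reasoning

  capDigits-≥ : ∀ {m n c} → (∀ r → r < b → m * r ≤ n * (r ⊓ c)) → ∀ j t → t < b ^ j → m * t ≤ n * capDigits c j t
  capDigits-≥ {m} {n} {c} digitwise zero zero _ = ℕ.≤-reflexive (trans (ℕ.*-zeroʳ m) (sym (ℕ.*-zeroʳ n)))
  capDigits-≥ digitwise zero (suc t) (s≤s ())
  capDigits-≥ {m} {n} {c} digitwise (suc j) t t<b^[1+j] = begin
    m * t
      ≡⟨ cong (m *_) (m≡m%n+[m/n]*n t b) ⟩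
    m * (t % b + t / b * b)
      ≡⟨ solve 4 (λ m r q b → m :* (r :+ q :* b) := b :* (m :* q) :+ m :* r) refl m (t % b) (t / b) b ⟩
    b * (m * (t / b)) + m * (t % b)
      ≤⟨ ℕ.+-mono-≤ (ℕ.*-monoʳ-≤ b (capDigits-≥ {m} {n} {c} digitwise j (t / b) t/b<b^j)) (digitwise (t % b) (m%n<n t b)) ⟩
    b * (n * capDigits c j (t / b)) + n * ((t % b) ⊓ c)
      ≡⟨ solve 4 (λ b n x y → b :* (n :* x) :+ n :* y := n :* (b :* x :+ y)) refl b n (capDigits c j (t / b)) ((t % b) ⊓ c) ⟩
    n * capDigits c (suc j) t ∎
    where
    open ℕ.≤-Reasoning
    t/b<b^j : t / b < b ^ j
    t/b<b^j = m<n*o⇒m/o<n (subst (t <_) (ℕ.*-comm b (b ^ j)) t<b^[1+j])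


module BinomialCoefficients where

  open import Data.Nat.Base using (zero; suc; _+_; _*_)
  open import Data.Nat.Properties using (*-zeroʳ; *-identityˡ; *-identityʳ)
  open import Data.Nat.Combinatorics using (_C_; nC1≡n; nCk+nC[k+1]≡[n+1]C[k+1])
  open import Data.Nat.Solver using (module +-*-Solver)
  open import Relation.Binary.PropositionalEquality using (_≡_; refl; sym; trans; cong; cong₂; module ≡-Reasoning)
  open +-*-Solver

  [1+k]*[1+n]C[1+k]≡[1+n]*nCk : ∀ n k → suc k * (suc n C suc k) ≡ suc n * (n C k)
  [1+k]*[1+n]C[1+k]≡[1+n]*nCk zero zero = refl
  [1+k]*[1+n]C[1+k]≡[1+n]*nCk zero (suc k) = *-zeroʳ (suc (suc k))
  [1+k]*[1+n]C[1+k]≡[1+n]*nCk (suc n) zero = trans (*-identityˡ _) (trans (nC1≡n (suc (suc n))) (sym (*-identityʳ _)))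
  [1+k]*[1+n]C[1+k]≡[1+n]*nCk (suc n) (suc k) = begin
    suc (suc k) * (suc (suc n) C suc (suc k))
      ≡⟨ cong (suc (suc k) *_) (nCk+nC[k+1]≡[n+1]C[k+1] (suc n) (suc k)) ⟨
    suc (suc k) * (x + y)
      ≡⟨ solve 3 (λ k x y → (con 2 :+ k) :* (x :+ y) := x :+ (con 1 :+ k) :* x :+ (con 2 :+ k) :* y) refl k x y ⟩
    x + suc k * x + suc (suc k) * y
      ≡⟨ cong₂ (λ u v → x + u + v) ([1+k]*[1+n]C[1+k]≡[1+n]*nCk n k) ([1+k]*[1+n]C[1+k]≡[1+n]*nCk n (suc k)) ⟩
    x + suc n * (n C k) + suc n * (n C suc k)
      ≡⟨ solve 4 (λ x n a b → x :+ (con 1 :+ n) :* a :+ (con 1 :+ n) :* b := x :+ (con 1 :+ n) :* (a :+ b)) refl x n (n C k) (n C suc k) ⟩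
    x + suc n * (n C k + n C suc k)
      ≡⟨ cong (λ z → x + suc n * z) (nCk+nC[k+1]≡[n+1]C[k+1] n k) ⟩
    x + suc n * x ∎
    where
    open ≡-Reasoning
    x y : ℕ
    x = suc n C suc k
    y = suc n C suc (suc k)

module CharacteristicP (F : FiniteField) (p′ : ℕ) (p-prime : Prime (suc p′)) where

  open FieldArithmetic F
  open BinomialCoefficients
  open import Data.Nat as ℕ using (zero; suc; _⊓_; _<_; _≤_; z≤n; s≤s; >-nonZero)
  import Data.Nat.Properties as ℕ
  open import Data.Nat.Combinatorics using (_C_; nCn≡1; k>n⇒nCk≡0; nCk+nC[k+1]≡[n+1]C[k+1])
  open import Data.Nat.Coprimality using (prime⇒coprime; coprime-Bézout)
  open import Data.Nat.GCD using (module Bézout)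
  open import Data.Nat.DivMod using (_/_; _%_)
  open import Relation.Binary.PropositionalEquality
  open import Relation.Nullary using (¬_)
  import Data.Nat.Solver as ℕ-Solver
  open ℕ-Solver.+-*-Solver using () renaming (solve to solveℕ; _:=_ to _:=ℕ_; _:+_ to _:+ℕ_; _:*_ to _:*ℕ_; con to conℕ)

  p : ℕ
  p = suc p′

  open BaseDigits p

  module _ (p×1≡0 : p × 1# ≡ 0#) where

    1×1≡1 : 1 × 1# ≡ 1#
    1×1≡1 = +-identityʳ 1#

    private
      1+uv≢wz : ∀ {u v w z} → v × 1# ≡ 0# → z × 1# ≡ 0# → ¬ 1 ℕ.+ u ℕ.* v ≡ w ℕ.* z
      1+uv≢wz {u} {v} {w} {z} v×1≡0 z×1≡0 eq = 1≢0 (begin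
        1#                              ≡⟨ trans (cong (1# +_) (zeroʳ _)) (+-identityʳ 1#) ⟨
        1# + u × 1# * 0#                ≡⟨ cong (λ y → 1# + u × 1# * y) v×1≡0 ⟨
        1# + u × 1# * v × 1#            ≡⟨ cong (1# +_) (×1-homo-* u v) ⟨
        (1 ℕ.+ u ℕ.* v) × 1#            ≡⟨ cong (_× 1#) eq ⟩
        (w ℕ.* z) × 1#                  ≡⟨ ×1-homo-* w z ⟩
        w × 1# * z × 1#                 ≡⟨ cong (w × 1# *_) z×1≡0 ⟩
        w × 1# * 0#                     ≡⟨ zeroʳ _ ⟩
        0#                              ∎)
        where open ≡-Reasoning

    ×1≢0 : ∀ {m} → 0 < m → m < p → ¬ m × 1# ≡ 0#
    ×1≢0 {m} 0<m m<p m×1≡0 with coprime-Bézout (prime⇒coprime p-prime {{>-nonZero 0<m}} m<p)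
    ... | Bézout.+- x y 1+ym≡xp = 1+uv≢wz {y} {m} {x} {p} m×1≡0 p×1≡0 1+ym≡xp
    ... | Bézout.-+ x y 1+xp≡ym = 1+uv≢wz {x} {p} {y} {m} p×1≡0 m×1≡0 1+xp≡ym

    private
      absorption : ∀ n k → suc k × 1# * (suc n C suc k) × 1# ≡ suc n × 1# * (n C k) × 1#
      absorption n k = begin
        suc k × 1# * (suc n C suc k) × 1#     ≡⟨ ×1-homo-* (suc k) (suc n C suc k) ⟨
        (suc k ℕ.* (suc n C suc k)) × 1#      ≡⟨ cong (_× 1#) ([1+k]*[1+n]C[1+k]≡[1+n]*nCk n k) ⟩
        (suc n ℕ.* (n C k)) × 1#              ≡⟨ ×1-homo-* (suc n) (n C k) ⟩
        suc n × 1# * (n C k) × 1#             ∎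
        where open ≡-Reasoning

    C×1≢0 : ∀ {n c} → c ≤ n → n < p → ¬ (n C c) × 1# ≡ 0#
    C×1≢0 {n} {zero} _ _ = subst (λ x → ¬ x ≡ 0#) (sym 1×1≡1) 1≢0
    C×1≢0 {suc n} {suc c} (s≤s c≤n) 1+n<p C×1≡0 =
      *-≢0 (×1≢0 (s≤s z≤n) 1+n<p) (C×1≢0 c≤n (ℕ.<-trans (ℕ.n<1+n n) 1+n<p))
        (trans (sym (absorption n c)) (trans (cong (suc c × 1# *_) C×1≡0) (zeroʳ _)))

    pCj×1≡0 : ∀ {j} → 0 < j → j < p → (p C j) × 1# ≡ 0#
    pCj×1≡0 {suc j} _ 1+j<p = x*y≡0⇒y≡0 (×1≢0 (s≤s z≤n) 1+j<p)
      (trans (absorption p′ j) (trans (cong (_* (p′ C j) × 1#) p×1≡0) (zeroˡ _)))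

    private
      1×1≡1×1*1×1 : 1 × 1# ≡ 1 × 1# * 1 × 1#
      1×1≡1×1*1×1 = sym (trans (cong (1 × 1# *_) 1×1≡1) (*-identityʳ _))

      pascal×1 : ∀ n k → (suc n C suc k) × 1# ≡ (n C k) × 1# + (n C suc k) × 1#
      pascal×1 n k = trans (cong (_× 1#) (sym (nCk+nC[k+1]≡[n+1]C[k+1] n k))) (×-homo-+ 1# (n C k) (n C suc k))

    -- Digits are written least significant first, b + a p, so that every
    -- case below unfolds definitionally.
    lucas : ∀ a b a′ c → b < p → c < p → ((b ℕ.+ a ℕ.* p) C (c ℕ.+ a′ ℕ.* p)) × 1# ≡ (a C a′) × 1# * (b C c) × 1#
    lucas zero zero zero zero _ _ = 1×1≡1×1*1×1
    lucas zero zero a′ (suc c) _ _ = sym (zeroʳ _)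
    lucas zero zero (suc a′) zero _ _ = sym (zeroˡ _)
    lucas a (suc b) zero zero _ _ = 1×1≡1×1*1×1
    lucas (suc a) zero zero zero _ _ = 1×1≡1×1*1×1
    lucas a (suc b) a′ (suc c) 1+b<p 1+c<p = begin
      (suc N C suc K) × 1#
        ≡⟨ pascal×1 N K ⟩
      (N C K) × 1# + (N C suc K) × 1#
        ≡⟨ cong₂ _+_ (lucas a b a′ c b<p c<p) (lucas a b a′ (suc c) b<p 1+c<p) ⟩
      A * (b C c) × 1# + A * (b C suc c) × 1#
        ≡⟨ distribˡ A _ _ ⟨
      A * ((b C c) × 1# + (b C suc c) × 1#)
        ≡⟨ cong (A *_) (pascal×1 b c) ⟨
      A * (suc b C suc c) × 1# ∎
      where
      open ≡-Reasoning
      N K : ℕ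
      N = b ℕ.+ a ℕ.* p
      K = c ℕ.+ a′ ℕ.* p
      A : Carrier
      A = (a C a′) × 1#
      b<p : b < p
      b<p = ℕ.<-trans (ℕ.n<1+n b) 1+b<p
      c<p : c < p
      c<p = ℕ.<-trans (ℕ.n<1+n c) 1+c<p
    lucas a (suc b) (suc a′) zero 1+b<p _ = begin
      (suc N C suc K) × 1#
        ≡⟨ pascal×1 N K ⟩
      (N C K) × 1# + (N C suc K) × 1#
        ≡⟨ cong₂ _+_ (lucas a b a′ p′ b<p (ℕ.n<1+n p′)) (lucas a b (suc a′) zero b<p (s≤s z≤n)) ⟩
      (a C a′) × 1# * (b C p′) × 1# + (a C suc a′) × 1# * (b C 0) × 1#
        ≡⟨ cong (λ m → (a C a′) × 1# * m × 1# + (a C suc a′) × 1# * 1 × 1#) (k>n⇒nCk≡0 (ℕ.≤-pred 1+b<p)) ⟩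
      (a C a′) × 1# * 0# + (a C suc a′) × 1# * 1 × 1#
        ≡⟨ cong (_+ (a C suc a′) × 1# * 1 × 1#) (zeroʳ _) ⟩
      0# + (a C suc a′) × 1# * 1 × 1#
        ≡⟨ +-identityˡ _ ⟩
      (a C suc a′) × 1# * (suc b C 0) × 1# ∎
      where
      open ≡-Reasoning
      N K : ℕ
      N = b ℕ.+ a ℕ.* p
      K = p′ ℕ.+ a′ ℕ.* p
      b<p : b < p
      b<p = ℕ.<-trans (ℕ.n<1+n b) 1+b<p
    lucas (suc a) zero a′ (suc c) _ 1+c<p = begin
      (suc N C suc K) × 1#
        ≡⟨ pascal×1 N K ⟩
      (N C K) × 1# + (N C suc K) × 1#
        ≡⟨ cong₂ _+_ (lucas a p′ a′ c (ℕ.n<1+n p′) c<p) (lucas a p′ a′ (suc c) (ℕ.n<1+n p′) 1+c<p) ⟩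
      A * (p′ C c) × 1# + A * (p′ C suc c) × 1#
        ≡⟨ distribˡ A _ _ ⟨
      A * ((p′ C c) × 1# + (p′ C suc c) × 1#)
        ≡⟨ cong (A *_) (trans (sym (pascal×1 p′ c)) (pCj×1≡0 (s≤s z≤n) 1+c<p)) ⟩
      A * 0#
        ≡⟨ zeroʳ A ⟩
      0#
        ≡⟨ zeroʳ _ ⟨
      (suc a C a′) × 1# * (0 C suc c) × 1# ∎
      where
      open ≡-Reasoning
      N K : ℕ
      N = p′ ℕ.+ a ℕ.* p
      K = c ℕ.+ a′ ℕ.* p
      A : Carrier
      A = (a C a′) × 1#
      c<p : c < p
      c<p = ℕ.<-trans (ℕ.n<1+n c) 1+c<p
    lucas (suc a) zero (suc a′) zero _ _ = begin
      (suc N C suc K) × 1#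
        ≡⟨ pascal×1 N K ⟩
      (N C K) × 1# + (N C suc K) × 1#
        ≡⟨ cong₂ _+_ (lucas a p′ a′ p′ (ℕ.n<1+n p′) (ℕ.n<1+n p′)) (lucas a p′ (suc a′) zero (ℕ.n<1+n p′) (s≤s z≤n)) ⟩
      (a C a′) × 1# * (p′ C p′) × 1# + (a C suc a′) × 1# * 1 × 1#
        ≡⟨ cong (λ m → (a C a′) × 1# * m × 1# + (a C suc a′) × 1# * 1 × 1#) (nCn≡1 p′) ⟩
      (a C a′) × 1# * 1 × 1# + (a C suc a′) × 1# * 1 × 1#
        ≡⟨ distribʳ (1 × 1#) _ _ ⟨
      ((a C a′) × 1# + (a C suc a′) × 1#) * 1 × 1#
        ≡⟨ cong (_* 1 × 1#) (pascal×1 a a′) ⟨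
      (suc a C suc a′) × 1# * (0 C 0) × 1# ∎
      where
      open ≡-Reasoning
      N K : ℕ
      N = p′ ℕ.+ a ℕ.* p
      K = p′ ℕ.+ a′ ℕ.* p

    -- e · repunit j has all its base-p digits equal to e, and adding a number
    -- whose digits are at most c < p - e produces no carries.
    repunit-capDigits-C×1≢0 : ∀ {e c} → e ℕ.+ c < p → ∀ j t →
      ¬ ((e ℕ.* repunit j ℕ.+ capDigits c j t) C (e ℕ.* repunit j)) × 1# ≡ 0#
    repunit-capDigits-C×1≢0 {e} {c} e+c<p zero t =
      subst (λ n → ¬ ((n ℕ.+ 0) C n) × 1# ≡ 0#) (sym (ℕ.*-zeroʳ e)) (C×1≢0 z≤n (s≤s z≤n))
    repunit-capDigits-C×1≢0 {e} {c} e+c<p (suc j) t C×1≡0 = *-≢0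
      (repunit-capDigits-C×1≢0 {e} {c} e+c<p j (t / p))
      (C×1≢0 {e ℕ.+ m₀} {e} (ℕ.m≤m+n e m₀) (ℕ.≤-<-trans (ℕ.+-monoʳ-≤ e (ℕ.m⊓n≤n (t % p) c)) e+c<p))
      (trans (sym (lucas (e ℕ.* R ℕ.+ M) (e ℕ.+ m₀) (e ℕ.* R) e (ℕ.≤-<-trans (ℕ.+-monoʳ-≤ e (ℕ.m⊓n≤n (t % p) c)) e+c<p) e<p))
        (trans (cong₂ (λ n k → (n C k) × 1#) N≡ K≡) C×1≡0))
      where
      R M m₀ : ℕ
      R = repunit j
      M = capDigits c j (t / p)
      m₀ = (t % p) ⊓ c
      e<p : e < p
      e<p = ℕ.≤-<-trans (ℕ.m≤m+n e c) e+c<p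
      N≡ : (e ℕ.+ m₀) ℕ.+ (e ℕ.* R ℕ.+ M) ℕ.* p ≡ e ℕ.* repunit (suc j) ℕ.+ capDigits c (suc j) t
      N≡ = solveℕ 5 (λ e m₀ r m p → (e :+ℕ m₀) :+ℕ (e :*ℕ r :+ℕ m) :*ℕ p :=ℕ e :*ℕ (conℕ 1 :+ℕ p :*ℕ r) :+ℕ (p :*ℕ m :+ℕ m₀)) refl e m₀ R M p
      K≡ : e ℕ.+ (e ℕ.* R) ℕ.* p ≡ e ℕ.* repunit (suc j)
      K≡ = solveℕ 3 (λ e r p → e :+ℕ (e :*ℕ r) :*ℕ p :=ℕ e :*ℕ (conℕ 1 :+ℕ p :*ℕ r)) refl e R p

module SquareRootEstimate where

  open import Data.Nat.Base using (suc; _+_; _*_; _^_; _∸_; _≤_; _<_; s≤s)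
  open import Data.Nat.Properties
  open import Relation.Binary.PropositionalEquality
  open import Relation.Nullary using (yes; no; contradiction)
  open import Data.Nat.Solver using (module +-*-Solver)
  open +-*-Solver

  private
    x^2≡x*x : ∀ x → x ^ 2 ≡ x * x
    x^2≡x*x x = cong (x *_) (*-identityʳ x)

    -- With d = a + 1 and X = 8dt - 4r: from d X² ≥ r² (8d + 1)² we get
    -- X ≥ 8√d r ≥ 10 r, and then (d - 1)(X + 4r)² ≥ 64 d² r² as d ≥ 3.
    square-bound⁻¹ : ∀ a r t → 2 ≤ a → 1 ≤ r →
      (r * r) * ((8 * suc a + 1) ^ 2) ≤ suc a * ((8 * suc a * t ∸ 4 * r) ^ 2) → r * r ≤ a * (t * t)
    square-bound⁻¹ a r t 2≤a 1≤r hyp = *-cancelˡ-≤ (64 * d * d) {{nonZero}} 64d²r²≤64d²at²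
      where
      open ≤-Reasoning
      d X : ℕ
      d = suc a
      X = 8 * d * t ∸ 4 * r
      nonZero : NonZero (64 * d * d)
      nonZero = _

      64dr²≤X² : 64 * d * (r * r) ≤ X * X
      64dr²≤X² = *-cancelˡ-≤ d (begin
        d * (64 * d * (r * r))
          ≡⟨ solve 2 (λ d s → d :* (con 64 :* d :* s) := s :* (con 64 :* d :* d)) refl d (r * r) ⟩
        (r * r) * (64 * d * d)
          ≤⟨ *-monoʳ-≤ (r * r) (m≤m+n (64 * d * d) (16 * d + 1)) ⟩
        (r * r) * (64 * d * d + (16 * d + 1)) ≡⟨ cong ((r * r) *_) (solve 1 (λ d → con 64 :* d :* d :+ (con 16 :* d :+ con 1) := (con 8 :* d :+ con 1) :^ 2) refl d) ⟩
        (r * r) * ((8 * d + 1) ^ 2)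
          ≤⟨ hyp ⟩
        d * (X ^ 2)
          ≡⟨ cong (d *_) (x^2≡x*x X) ⟩
        d * (X * X) ∎)

      10r≤X : 10 * r ≤ X
      10r≤X with 10 * r ≤? X
      ... | yes 10r≤X = 10r≤X
      ... | no 10r≰X = contradiction 64dr²≤X² (<⇒≱ (begin-strict
        X * X                  <⟨ *-mono-< (≰⇒> 10r≰X) (≰⇒> 10r≰X) ⟩
        10 * r * (10 * r)      ≡⟨ solve 1 (λ r → con 10 :* r :* (con 10 :* r) := con 100 :* (r :* r)) refl r ⟩
        100 * (r * r)          ≤⟨ *-monoˡ-≤ (r * r) (≤-trans (m≤m+n 100 92) (*-monoʳ-≤ 64 (s≤s 2≤a))) ⟩
        64 * d * (r * r)       ∎))

      8dt≡X+4r : 8 * d * t ≡ X + 4 * r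
      8dt≡X+4r = sym (m∸n+n≡m {8 * d * t} {4 * r} (<⇒≤ (m∸n≢0⇒n<m X≢0)))
        where
        X≢0 : X ≢ 0
        X≢0 X≡0 = contradiction (subst (10 * r ≤_) X≡0 10r≤X) (<⇒≱ (*-monoʳ-< 10 1≤r))

      64d²r²≤64d²at² : 64 * d * d * (r * r) ≤ 64 * d * d * (a * (t * t))
      64d²r²≤64d²at² = begin
        64 * d * d * (r * r)
          ≡⟨ solve 2 (λ a s → con 64 :* (con 1 :+ a) :* (con 1 :+ a) :* s := a :* (con 64 :* (con 1 :+ a) :* s) :+ con 64 :* a :* s :+ con 64 :* s) refl a (r * r) ⟩
        a * (64 * d * (r * r)) + 64 * a * (r * r) + 64 * (r * r)
          ≤⟨ +-monoʳ-≤ (a * (64 * d * (r * r)) + 64 * a * (r * r)) (*-monoˡ-≤ (r * r) (*-monoʳ-≤ 32 2≤a)) ⟩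
        a * (64 * d * (r * r)) + 64 * a * (r * r) + 32 * a * (r * r)
          ≡⟨ solve 2 (λ a r → a :* (con 64 :* (con 1 :+ a) :* (r :* r)) :+ con 64 :* a :* (r :* r) :+ con 32 :* a :* (r :* r)
                           := a :* (con 64 :* (con 1 :+ a) :* (r :* r)) :+ con 8 :* a :* r :* (con 10 :* r) :+ con 16 :* a :* (r :* r)) refl a r ⟩
        a * (64 * d * (r * r)) + 8 * a * r * (10 * r) + 16 * a * (r * r)
          ≤⟨ +-monoˡ-≤ (16 * a * (r * r)) (+-mono-≤ (*-monoʳ-≤ a 64dr²≤X²) (*-monoʳ-≤ (8 * a * r) 10r≤X)) ⟩
        a * (X * X) + 8 * a * r * X + 16 * a * (r * r)
          ≡⟨ solve 3 (λ a x r → a :* (x :* x) :+ con 8 :* a :* r :* x :+ con 16 :* a :* (r :* r) := a :* ((x :+ con 4 :* r) :* (x :+ con 4 :* r))) refl a X r ⟩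
        a * ((X + 4 * r) * (X + 4 * r))
          ≡⟨ cong (λ y → a * (y * y)) 8dt≡X+4r ⟨
        a * (8 * d * t * (8 * d * t))
          ≡⟨ solve 3 (λ a d t → a :* (con 8 :* d :* t :* (con 8 :* d :* t)) := con 64 :* d :* d :* (a :* (t :* t))) refl a d t ⟩
        64 * d * d * (a * (t * t)) ∎

  -- Over the reals: t < r / √(d - 1) implies t < (r / √d) (1 + 1 / (2√d) + 1 / (8d)).
  relax-square-bound : ∀ d r t → 3 ≤ d → (d ∸ 1) * (t * t) < r * r →
    d * ((8 * d * t ∸ 4 * r) ^ 2) < (r * r) * ((8 * d + 1) ^ 2)
  relax-square-bound (suc a) r t (s≤s 2≤a) bound
    with suc a * ((8 * suc a * t ∸ 4 * r) ^ 2) <? (r * r) * ((8 * suc a + 1) ^ 2)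
  ... | yes goal = goal
  ... | no ¬goal = contradiction bound (≤⇒≯ (square-bound⁻¹ a r t 2≤a 1≤r (≮⇒≥ ¬goal)))
    where
    1≤r : 1 ≤ r
    1≤r = n≢0⇒n>0 λ { refl → n≮0 (subst ((suc a ∸ 1) * (t * t) <_) (*-zeroʳ 0) bound) }

module GeneralizedPaley (F : FiniteField) where

  open FieldArithmetic F
  open FiniteFieldFacts F using (fermat; characteristic; length≤size; 2≤size)
  open Stepanov F using (stepanov)
  open import Data.Nat as ℕ using (zero; suc; _∸_; _⊓_; _<_; _≤_; z≤n; s≤s)
  import Data.Nat.Properties as ℕ
  open import Data.Nat.Divisibility using (_∣_; divides)
  open import Data.List using (List; []; _∷_; length)
  open import Data.List.Membership.Propositional using (_∈_)
  open import Data.Product using (_,_)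
  open import Relation.Binary.PropositionalEquality
  open import Relation.Nullary using (¬_; yes; no; contradiction)
  open import Data.Nat.Primality using (¬prime[0])
  import Data.Nat.Solver as ℕ-Solver
  open ℕ-Solver.+-*-Solver using () renaming (solve to solveℕ; _:=_ to _:=ℕ_; _:+_ to _:+ℕ_; _:*_ to _:*ℕ_; con to conℕ)

  clique-differences : ∀ {d k C} → 1 ≤ d → size ≡ suc (d ℕ.* k) → IsGPClique F d C →
    ∀ {x y} → x ∈ C → y ∈ C → ¬ x ≡ y → (x - y) ^ k ≡ 1#
  clique-differences {d} {k} 1≤d q≡1+dk (_ , adjacent) {x} {y} x∈C y∈C x≢y with adjacent x∈C y∈C x≢y
  ... | _ , z , x-y≡zᵈ = begin
    (x - y) ^ k        ≡⟨ cong (_^ k) x-y≡zᵈ ⟩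
    (z ^ d) ^ k        ≡⟨ ^-*-assoc z d k ⟩
    z ^ (d ℕ.* k)      ≡⟨ fermat q≡1+dk z≢0 ⟩
    1#                 ∎
    where
    open ≡-Reasoning
    z≢0 : ¬ z ≡ 0#
    z≢0 z≡0 = x≢y (x-y≡0⇒x≡y (trans x-y≡zᵈ (trans (cong (_^ d) z≡0) (0^n≡0 1≤d))))

  0<size : 0 < size
  0<size = ℕ.<-trans (s≤s z≤n) 2≤size

  digit-bound : ∀ d′ e r → r ≤ e ℕ.* suc d′ → d′ ℕ.* r ≤ suc d′ ℕ.* (r ⊓ (d′ ℕ.* e))
  digit-bound d′ e r r≤ed with r ℕ.≤? d′ ℕ.* e
  ... | yes r≤c = subst (λ m → d′ ℕ.* r ≤ suc d′ ℕ.* m) (sym (ℕ.m≤n⇒m⊓n≡m r≤c)) (ℕ.*-monoˡ-≤ r (ℕ.n≤1+n d′))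
  ... | no r≰c = subst (λ m → d′ ℕ.* r ≤ suc d′ ℕ.* m) (sym (ℕ.m≥n⇒m⊓n≡n (ℕ.<⇒≤ (ℕ.≰⇒> r≰c)))) (begin
    d′ ℕ.* r                   ≤⟨ ℕ.*-monoʳ-≤ d′ r≤ed ⟩
    d′ ℕ.* (e ℕ.* suc d′)      ≡⟨ solveℕ 3 (λ d′ e d → d′ :*ℕ (e :*ℕ d) :=ℕ d :*ℕ (d′ :*ℕ e)) refl d′ e (suc d′) ⟩
    suc d′ ℕ.* (d′ ℕ.* e)      ∎)
    where open ℕ.≤-Reasoning

  clique-bound : ∀ {p s d} → Prime p → size ≡ p ℕ.^ s → d ∣ p ∸ 1 → (C : List Carrier) → IsGPClique F d C →
    (d ∸ 1) ℕ.* ((length C ∸ 1) ℕ.* (length C ∸ 1)) < size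
  clique-bound {zero} p-prime _ _ _ _ = contradiction p-prime ¬prime[0]
  clique-bound {d = zero} _ _ _ _ _ = 0<size
  clique-bound {suc p′} {d = suc d′} _ _ _ [] _ = subst (_< size) (sym (ℕ.*-zeroʳ d′)) 0<size
  clique-bound {suc p′} {s} {suc d′} p-prime q≡pˢ (divides e p′≡ed) C@(_ ∷ xs) C-clique@(C-unique , _) = begin-strict
    d′ ℕ.* (t ℕ.* t)
      ≡⟨ ℕ.*-assoc d′ t t ⟨
    d′ ℕ.* t ℕ.* t
      ≤⟨ ℕ.*-monoˡ-≤ t (capDigits-≥ {d′} {d} {d′ ℕ.* e} (λ r r<p → digit-bound d′ e r (subst (r ≤_) p′≡ed (ℕ.≤-pred r<p))) s t t<pˢ) ⟩
    d ℕ.* M ℕ.* t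
      ≤⟨ ℕ.*-monoʳ-≤ (d ℕ.* M) (ℕ.n≤1+n t) ⟩
    d ℕ.* M ℕ.* suc t
      ≡⟨ ℕ.*-assoc d M (suc t) ⟩
    d ℕ.* (M ℕ.* suc t)
      ≤⟨ ℕ.*-monoʳ-≤ d MN≤k ⟩
    d ℕ.* k
      <⟨ ℕ.n<1+n (d ℕ.* k) ⟩
    suc (d ℕ.* k)
      ≡⟨ q≡1+dk ⟨
    size ∎
    where
    open ℕ.≤-Reasoning
    open CharacteristicP F p′ p-prime using (repunit-capDigits-C×1≢0)
    open BaseDigits (suc p′) using (repunit; capDigits; [b∸1]*repunit+1≡b^; capDigits-≤; capDigits-≥)
    d t k M : ℕ
    d = suc d′
    t = length xs
    k = e ℕ.* repunit s
    M = capDigits (d′ ℕ.* e) s t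

    q≡1+dk : size ≡ suc (d ℕ.* k)
    q≡1+dk = begin-equality
      size
        ≡⟨ q≡pˢ ⟩
      suc p′ ℕ.^ s
        ≡⟨ [b∸1]*repunit+1≡b^ s ⟨
      p′ ℕ.* repunit s ℕ.+ 1
        ≡⟨ cong (λ m → m ℕ.* repunit s ℕ.+ 1) p′≡ed ⟩
      e ℕ.* d ℕ.* repunit s ℕ.+ 1
        ≡⟨ solveℕ 3 (λ e d r → e :*ℕ d :*ℕ r :+ℕ conℕ 1 :=ℕ conℕ 1 :+ℕ d :*ℕ (e :*ℕ r)) refl e d (repunit s) ⟩
      suc (d ℕ.* k) ∎

    1≤k : 1 ≤ k
    1≤k = ℕ.n≢0⇒n>0 λ k≡0 → ℕ.<-irrefl refl
      (ℕ.≤-trans 2≤size (ℕ.≤-reflexive (trans q≡1+dk (cong suc (trans (cong (d ℕ.*_) k≡0) (ℕ.*-zeroʳ d))))))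

    t<pˢ : t < suc p′ ℕ.^ s
    t<pˢ = subst (t <_) q≡pˢ (length≤size C-unique)

    e+d′e<p : e ℕ.+ d′ ℕ.* e < suc p′
    e+d′e<p = s≤s (ℕ.≤-reflexive (trans (ℕ.*-comm d e) (sym p′≡ed)))

    MN≤k : M ℕ.* suc t ≤ k
    MN≤k = stepanov k M C C-unique 1≤k (s≤s (capDigits-≤ (d′ ℕ.* e) s t))
      (repunit-capDigits-C×1≢0 (characteristic {suc p′} {s} q≡pˢ) {e} {d′ ℕ.* e} e+d′e<p s t)
      (clique-differences {d} {k} (s≤s z≤n) q≡1+dk C-clique)

open import Data.Nat using (ℕ; _+_; _*_; _∸_; _^_; _≤_; _<_)
open import Data.Nat.Divisibility using (_∣_)
open import Data.Nat.Primality using (Prime)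
open import Data.List using (List; length)
open import Relation.Binary.PropositionalEquality using (_≡_; subst)
open SquareRootEstimate using (relax-square-bound)
open GeneralizedPaley using (clique-bound)

theorem5p12 : (F : FiniteField) (p s r d : ℕ) → Prime p →
    FiniteField.size F ≡ p ^ s → FiniteField.size F ≡ r * r →
    3 ≤ d → d ∣ (p ∸ 1) →
    (C : List (FiniteField.Carrier F)) → IsGPClique F d C →
    d * ((8 * d * (length C ∸ 1) ∸ 4 * r) ^ 2) < (r * r) * ((8 * d + 1) ^ 2)
theorem5p12 F p s r d p-prime q≡pˢ q≡r² 3≤d d∣p∸1 C C-clique =
  relax-square-bound d r (length C ∸ 1) 3≤d (subst ((d ∸ 1) * ((length C ∸ 1) * (length C ∸ 1)) <_) q≡r²
    (clique-bound F {p} {s} p-prime q≡pˢ d∣p∸1 C C-clique))
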